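{- Let $p$ and $q$ be positive integers with $p,q\geq 2$ and $\gcd(p,q)=1$. Let $\omega_j=e^{2\pi i j/p}$ and $\xi_j=e^{2\pi i j/q}$. Then $$p\sum_{j=1}^{q-1}\frac{\xi_j}{(\xi_j-1)^3(\xi_j^p-1)}+q\sum_{j=1}^{p-1}\frac{\omega_j}{(\omega_j-1)^3(\omega_j^q-1)}=\frac{1}{720}\left(p^4+q^4-5p^2q^2-15p^2q-15pq^2+15p+15q+3\right).$$ -}

module Defs where

open import Level using (Level; _⊔_) renaming (suc to lsuc)
open import Algebra.Bundles using (CommutativeRing)
open import Data.Nat using (ℕ; zero; suc; _≤_; _<_)
open import Data.Integer using (ℤ; +_; -[1+_])
open import Relation.Nullary using (¬_)

record Field (c ℓ : Level) : Set (lsuc (c ⊔ ℓ)) where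
  field
    commutativeRing : CommutativeRing c ℓ
  open CommutativeRing commutativeRing public
  field
    _⁻¹      : Carrier → Carrier
    1≉0      : ¬ (1# ≈ 0#)
    ⁻¹-inverse : ∀ x → ¬ (x ≈ 0#) → x * (x ⁻¹) ≈ 1#

module FieldOps {c ℓ : Level} (F : Field c ℓ) where
  open Field F

  pow : Carrier → ℕ → Carrier
  pow x zero    = 1#
  pow x (suc n) = x * pow x n

  fromℕ : ℕ → Carrier
  fromℕ zero    = 0#
  fromℕ (suc n) = 1# + fromℕ n

  fromℤ : ℤ → Carrier
  fromℤ (+ n)     = fromℕ n
  fromℤ -[1+ n ]  = - fromℕ (suc n)

  sumBelow : ℕ → (ℕ → Carrier) → Carrier
  sumBelow zero    f = 0#
  sumBelow (suc n) f = sumBelow n f + f n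

  sum₁ : ℕ → (ℕ → Carrier) → Carrier
  sum₁ zero    f = 0#
  sum₁ (suc m) f = sumBelow m (λ i → f (suc i))

  _/_ : Carrier → Carrier → Carrier
  x / y = x * (y ⁻¹)

  CharZero : Set ℓ
  CharZero = ∀ n → ¬ (fromℕ (suc n) ≈ 0#)

  record PrimitiveRoot (N : ℕ) (ζ : Carrier) : Set ℓ where
    field
      root      : pow ζ N ≈ 1#
      minimal   : ∀ k → 1 ≤ k → k < N → ¬ (pow ζ k ≈ 1#)

module _ where
  open import Data.Integer using (_+_; _-_; _*_; _^_)
  rhsPoly : ℕ → ℕ → ℤ
  rhsPoly p q =
    let P = + p ; Q = + q in
    P ^ 4 + Q ^ 4 - + 5 * (P ^ 2 * Q ^ 2) - + 15 * (P ^ 2 * Q)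
      - + 15 * (P * Q ^ 2) + + 15 * P + + 15 * Q + + 3

{-# OPTIONS --safe #-}
-- As gcd(p, q) = 1, the q-th roots of unity together with the p-th roots of unity other than 1
-- are the p + q - 1 distinct roots of N(z) = (z^q - 1)(z^p - 1) / (z - 1). Let
-- E(w) = ((1 + w)^q - 1)((1 + w)^p - 1) / w², let T be the truncation of e₀⁴ / E(w) after w³,
-- and let G be the polynomial with (z - 1)⁴ G(z) = e₀⁴ - T(z - 1) E(z - 1). As deg G < deg N - 1,
-- the interpolation weights G(x) / N′(x) over the roots x of N sum to zero. At a root x ≠ 1,
-- (x - 1)⁴ G(x) = e₀⁴, so the weight is e₀⁴ / q (resp. e₀⁴ / p) times the summand of the theorem;
-- at x = 1 it is G(1) / (pq) with -G(1) = [w⁴] T(w) E(w). Hence the left-hand side equals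
-- [w⁴] (T E) / e₀⁴, a polynomial in the Taylor coefficients (q choose k + 1), (p choose k + 1)
-- of E, which expands to the right-hand side.
module Submission where

open import Defs
open import Level using (Level)
open import Data.Nat using (ℕ; _≤_; suc; s≤s)
open import Data.Nat.GCD using (gcd)
open import Relation.Binary.PropositionalEquality using (_≡_)

module NatBounds where
  open import Data.Nat
  open import Data.Nat.Properties
  open import Relation.Binary.PropositionalEquality using (cong)
  open ≤-Reasoning

  i≤a∧a+b<k⇒b<k∸i : ∀ {i a b k} → i ≤ a → a + b < k → b < k ∸ i
  i≤a∧a+b<k⇒b<k∸i {i} {a} {b} {k} i≤a a+b<k = m+n≤o⇒m≤o∸n (suc b) (begin
    suc b + i    ≤⟨ +-monoʳ-≤ (suc b) i≤a ⟩
    suc (b + a)  ≡⟨ cong suc (+-comm b a) ⟩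
    suc (a + b)  ≤⟨ a+b<k ⟩
    k            ∎)

  i<a⇒b<a+b∸i : ∀ {i a b} → i < a → b < a + b ∸ i
  i<a⇒b<a+b∸i {i} {a} {b} i<a = m+n≤o⇒m≤o∸n (suc b) (begin
    suc b + i    ≡⟨ +-suc b i ⟨
    b + suc i    ≤⟨ +-monoʳ-≤ b i<a ⟩
    b + a        ≡⟨ +-comm b a ⟩
    a + b        ∎)

module Concatenation where
  open import Data.Nat
  open import Data.Nat.Properties
  open import Relation.Nullary using (yes; no; contradiction)
  open import Relation.Binary.PropositionalEquality

  concat : ∀ {a} {A : Set a} → ℕ → (ℕ → A) → (ℕ → A) → ℕ → A
  concat m f g i with i <? m
  ... | yes _ = f i
  ... | no  _ = g (i ∸ m)

  module _ {a} {A : Set a} {m : ℕ} (f g : ℕ → A) where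

    concat-< : ∀ {i} → i < m → concat m f g i ≡ f i
    concat-< {i} i<m with i <? m
    ... | yes _   = refl
    ... | no  i≮m = contradiction i<m i≮m

    concat-+ : ∀ k → concat m f g (m + k) ≡ g k
    concat-+ k with m + k <? m
    ... | yes m+k<m = contradiction m+k<m (m+n≮m m k)
    ... | no  _     = cong g (m+n∸m≡n m k)

  data Split (m n : ℕ) : ℕ → Set where
    first  : ∀ {i} → i < m → Split m n i
    second : ∀ {k} → k < n → Split m n (m + k)

  split : ∀ m n {i} → i < m + n → Split m n i
  split m n {i} i<m+n with i <? m
  ... | yes i<m = first i<m
  ... | no  i≮m = subst (Split m n) (m+[n∸m]≡n m≤i) (second (+-cancelˡ-< m (i ∸ m) n i-m<n))
    where
    m≤i : m ≤ i
    m≤i = ≮⇒≥ i≮m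
    i-m<n : m + (i ∸ m) < m + n
    i-m<n = subst (_< m + n) (sym (m+[n∸m]≡n m≤i)) i<m+n

module FieldProperties {c ℓ : Level} (F : Field c ℓ) where
  open import Data.Nat as ℕ using (zero)
  import Data.Nat.Properties as ℕₚ
  import Data.Integer as ℤ
  open ℤ using (ℤ; -[1+_])
  import Data.Integer.Properties as ℤₚ
  open import Data.Maybe using (Maybe; just; nothing)
  open import Relation.Nullary using (yes; no)
  import Relation.Binary.PropositionalEquality as ≡
  open import Algebra.Solver.Ring.AlmostCommutativeRing
    using (AlmostCommutativeRing; _-Raw-AlmostCommutative⟶_; fromCommutativeRing)
  open import Data.Vec.Relation.Binary.Pointwise.Inductive as Pointwise using (Pointwise)

  open Field F public hiding (zero)
  open FieldOps F public
  open import Relation.Binary.Reasoning.Setoid setoid public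
  open import Algebra.Properties.Ring ring public using (-‿distribˡ-*; -‿distribʳ-*; -‿involutive; -0#≈0#)
  open import Algebra.Properties.Group +-group public using () renaming (x∙y⁻¹≈ε⇒x≈y to x-y≈0⇒x≈y)
  open import Algebra.Properties.AbelianGroup +-abelianGroup using (⁻¹-∙-comm)
  open import Algebra.Properties.CommutativeSemigroup +-commutativeSemigroup using (interchange)
  open import Algebra.Properties.Monoid.Mult +-monoid using (_×_; ×-homo-+)
  open import Algebra.Properties.Semiring.Mult semiring using (×1-homo-*)

  fromℕ≡×1 : ∀ n → fromℕ n ≡ n × 1#
  fromℕ≡×1 zero    = ≡.refl
  fromℕ≡×1 (suc n) = ≡.cong (λ x → 1# + x) (fromℕ≡×1 n)

  fromℕ-+ : ∀ m n → fromℕ (m ℕ.+ n) ≈ fromℕ m + fromℕ n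
  fromℕ-+ m n rewrite fromℕ≡×1 (m ℕ.+ n) | fromℕ≡×1 m | fromℕ≡×1 n = ×-homo-+ 1# m n

  fromℕ-* : ∀ m n → fromℕ (m ℕ.* n) ≈ fromℕ m * fromℕ n
  fromℕ-* m n rewrite fromℕ≡×1 (m ℕ.* n) | fromℕ≡×1 m | fromℕ≡×1 n = ×1-homo-* m n

  fromℤ-⊖ : ∀ m n → fromℤ (m ℤ.⊖ n) ≈ fromℕ m - fromℕ n
  fromℤ-⊖ m       zero    = sym (trans (+-congˡ -0#≈0#) (+-identityʳ _))
  fromℤ-⊖ zero    (suc n) = sym (+-identityˡ _)
  fromℤ-⊖ (suc m) (suc n) = begin
    fromℤ (suc m ℤ.⊖ suc n)          ≡⟨ ≡.cong fromℤ (ℤₚ.[1+m]⊖[1+n]≡m⊖n m n) ⟩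
    fromℤ (m ℤ.⊖ n)                  ≈⟨ fromℤ-⊖ m n ⟩
    fromℕ m - fromℕ n                  ≈⟨ +-identityˡ _ ⟨
    0# + (fromℕ m - fromℕ n)           ≈⟨ +-congʳ (-‿inverseʳ 1#) ⟨
    (1# - 1#) + (fromℕ m - fromℕ n)    ≈⟨ interchange 1# (fromℕ m) (- 1#) (- fromℕ n) ⟨
    (1# + fromℕ m) + (- 1# - fromℕ n)  ≈⟨ +-congˡ (⁻¹-∙-comm 1# (fromℕ n)) ⟩
    fromℕ (suc m) - fromℕ (suc n)      ∎

  fromℤ-+ : ∀ i j → fromℤ (i ℤ.+ j) ≈ fromℤ i + fromℤ j
  fromℤ-+ (ℤ.+ m)  (ℤ.+ n)  = fromℕ-+ m n
  fromℤ-+ (ℤ.+ m)  -[1+ n ] = fromℤ-⊖ m (suc n)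
  fromℤ-+ -[1+ m ] (ℤ.+ n)  = trans (fromℤ-⊖ n (suc m)) (+-comm _ _)
  fromℤ-+ -[1+ m ] -[1+ n ] = begin
    - fromℕ (suc (suc (m ℕ.+ n)))        ≡⟨ ≡.cong (λ k → - fromℕ k) (≡.sym (ℕₚ.+-suc (suc m) n)) ⟩
    - fromℕ (suc m ℕ.+ suc n)            ≈⟨ -‿cong (fromℕ-+ (suc m) (suc n)) ⟩
    - (fromℕ (suc m) + fromℕ (suc n))    ≈⟨ ⁻¹-∙-comm _ _ ⟨
    - fromℕ (suc m) + - fromℕ (suc n)    ∎

  fromℤ-neg : ∀ i → fromℤ (ℤ.- i) ≈ - fromℤ i
  fromℤ-neg (ℤ.+ zero)    = sym -0#≈0#
  fromℤ-neg (ℤ.+ (suc n)) = refl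
  fromℤ-neg -[1+ n ]      = sym (-‿involutive _)

  private
    fromℤ-*-pos : ∀ m j → fromℤ (ℤ.+ m ℤ.* j) ≈ fromℕ m * fromℤ j
    fromℤ-*-pos m (ℤ.+ n) = begin
      fromℤ (ℤ.+ m ℤ.* ℤ.+ n)  ≡⟨ ≡.cong fromℤ (≡.sym (ℤₚ.pos-* m n)) ⟩
      fromℕ (m ℕ.* n)          ≈⟨ fromℕ-* m n ⟩
      fromℕ m * fromℕ n        ∎
    fromℤ-*-pos m -[1+ n ] = begin
      fromℤ (ℤ.+ m ℤ.* -[1+ n ])          ≡⟨ ≡.cong fromℤ (≡.sym (ℤₚ.neg-distribʳ-* (ℤ.+ m) (ℤ.+ suc n))) ⟩
      fromℤ (ℤ.- (ℤ.+ m ℤ.* ℤ.+ suc n))   ≈⟨ fromℤ-neg (ℤ.+ m ℤ.* ℤ.+ suc n) ⟩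
      - fromℤ (ℤ.+ m ℤ.* ℤ.+ suc n)       ≈⟨ -‿cong (fromℤ-*-pos m (ℤ.+ suc n)) ⟩
      - (fromℕ m * fromℕ (suc n))         ≈⟨ -‿distribʳ-* _ _ ⟩
      fromℕ m * - fromℕ (suc n)           ∎

  fromℤ-* : ∀ i j → fromℤ (i ℤ.* j) ≈ fromℤ i * fromℤ j
  fromℤ-* (ℤ.+ m)  j = fromℤ-*-pos m j
  fromℤ-* -[1+ m ] j = begin
    fromℤ (-[1+ m ] ℤ.* j)           ≡⟨ ≡.cong fromℤ (≡.sym (ℤₚ.neg-distribˡ-* (ℤ.+ suc m) j)) ⟩
    fromℤ (ℤ.- (ℤ.+ suc m ℤ.* j))    ≈⟨ fromℤ-neg (ℤ.+ suc m ℤ.* j) ⟩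
    - fromℤ (ℤ.+ suc m ℤ.* j)        ≈⟨ -‿cong (fromℤ-*-pos (suc m) j) ⟩
    - (fromℕ (suc m) * fromℤ j)      ≈⟨ -‿distribˡ-* _ _ ⟩
    - fromℕ (suc m) * fromℤ j        ∎

  -- Numerals read by the ring solver: unlike fromℕ 1 = 1# + 0#, nat 1 is 1#
  -- itself, so that solver goals may mention 1# directly.
  nat : ℕ → Carrier
  nat zero          = 0#
  nat (suc zero)    = 1#
  nat (suc (suc n)) = 1# + nat (suc n)

  int : ℤ → Carrier
  int (ℤ.+ n)  = nat n
  int -[1+ n ] = - nat (suc n)

  nat≈fromℕ : ∀ n → nat n ≈ fromℕ n
  nat≈fromℕ zero          = refl
  nat≈fromℕ (suc zero)    = sym (+-identityʳ 1#)
  nat≈fromℕ (suc (suc n)) = +-congˡ (nat≈fromℕ (suc n))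

  int≈fromℤ : ∀ i → int i ≈ fromℤ i
  int≈fromℤ (ℤ.+ n)  = nat≈fromℕ n
  int≈fromℤ -[1+ n ] = -‿cong (nat≈fromℕ (suc n))

  int-+ : ∀ i j → int (i ℤ.+ j) ≈ int i + int j
  int-+ i j = trans (int≈fromℤ (i ℤ.+ j)) (trans (fromℤ-+ i j) (sym (+-cong (int≈fromℤ i) (int≈fromℤ j))))

  int-* : ∀ i j → int (i ℤ.* j) ≈ int i * int j
  int-* i j = trans (int≈fromℤ (i ℤ.* j)) (trans (fromℤ-* i j) (sym (*-cong (int≈fromℤ i) (int≈fromℤ j))))

  int-neg : ∀ i → int (ℤ.- i) ≈ - int i
  int-neg i = trans (int≈fromℤ (ℤ.- i)) (trans (fromℤ-neg i) (-‿cong (sym (int≈fromℤ i))))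

  int-homomorphism : ℤ.+-*-rawRing -Raw-AlmostCommutative⟶ fromCommutativeRing commutativeRing
  int-homomorphism = record
    { ⟦_⟧    = int
    ; +-homo = int-+
    ; *-homo = int-*
    ; -‿homo = int-neg
    ; 0-homo = refl
    ; 1-homo = refl
    }

  int-≟ : ∀ i j → Maybe (int i ≈ int j)
  int-≟ i j with i ℤ.≟ j
  ... | yes ≡.refl = just refl
  ... | no _       = nothing

  open import Algebra.Solver.Ring ℤ.+-*-rawRing (fromCommutativeRing commutativeRing) int-homomorphism int-≟ public
    using (solve; _:=_; _:+_; _:-_; _:*_; :-_; _:^_; con; var; Polynomial; ⟦_⟧)
  open import Algebra.Solver.Ring ℤ.+-*-rawRing (fromCommutativeRing commutativeRing) int-homomorphism int-≟
    using (op; [+]; [*])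
  open import Algebra.Properties.Semiring.Exp (AlmostCommutativeRing.semiring (fromCommutativeRing commutativeRing))
    using (^-congˡ)

  num : ∀ {m} → ℕ → Polynomial m
  num n = con (ℤ.+ n)

  ⟦⟧-cong : ∀ {m} (P : Polynomial m) {ρ σ} → Pointwise _≈_ ρ σ → ⟦ P ⟧ ρ ≈ ⟦ P ⟧ σ
  ⟦⟧-cong (op [+] P Q) ρ≈σ = +-cong (⟦⟧-cong P ρ≈σ) (⟦⟧-cong Q ρ≈σ)
  ⟦⟧-cong (op [*] P Q) ρ≈σ = *-cong (⟦⟧-cong P ρ≈σ) (⟦⟧-cong Q ρ≈σ)
  ⟦⟧-cong (con c)      ρ≈σ = refl
  ⟦⟧-cong (var i)      ρ≈σ = Pointwise.lookup ρ≈σ i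
  ⟦⟧-cong (P :^ n)     ρ≈σ = ^-congˡ n (⟦⟧-cong P ρ≈σ)
  ⟦⟧-cong (:- P)       ρ≈σ = -‿cong (⟦⟧-cong P ρ≈σ)

  nat-suc : ∀ n → nat (suc n) ≈ 1# + nat n
  nat-suc zero    = sym (+-identityʳ 1#)
  nat-suc (suc n) = refl

  nat-* : ∀ m n → nat (m ℕ.* n) ≈ nat m * nat n
  nat-* m n = trans (nat≈fromℕ (m ℕ.* n)) (trans (fromℕ-* m n) (sym (*-cong (nat≈fromℕ m) (nat≈fromℕ n))))

  CharZero⇒nat≉0 : CharZero → ∀ n → nat (suc n) ≉ 0#
  CharZero⇒nat≉0 charZero n n≈0 = charZero n (trans (sym (nat≈fromℕ (suc n))) n≈0)

  x*y≈0⇒y≈0 : ∀ {x y} → x ≉ 0# → x * y ≈ 0# → y ≈ 0#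
  x*y≈0⇒y≈0 {x} {y} x≉0 xy≈0 = begin
    y                ≈⟨ *-identityˡ y ⟨
    1# * y           ≈⟨ *-congʳ (trans (*-comm _ _) (⁻¹-inverse x x≉0)) ⟨
    (x ⁻¹ * x) * y   ≈⟨ *-assoc _ _ _ ⟩
    x ⁻¹ * (x * y)   ≈⟨ *-congˡ xy≈0 ⟩
    x ⁻¹ * 0#        ≈⟨ zeroʳ _ ⟩
    0#               ∎

  *-≉0 : ∀ {x y} → x ≉ 0# → y ≉ 0# → x * y ≉ 0#
  *-≉0 x≉0 y≉0 xy≈0 = y≉0 (x*y≈0⇒y≈0 x≉0 xy≈0)

  x≉y⇒x-y≉0 : ∀ {x y} → x ≉ y → x - y ≉ 0#
  x≉y⇒x-y≉0 x≉y x-y≈0 = x≉y (x-y≈0⇒x≈y _ _ x-y≈0)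

  *-cancelˡ : ∀ {x y z} → x ≉ 0# → x * y ≈ x * z → y ≈ z
  *-cancelˡ {x} {y} {z} x≉0 xy≈xz = x-y≈0⇒x≈y y z (x*y≈0⇒y≈0 x≉0 (begin
    x * (y - z)      ≈⟨ solve 3 (λ x y z → x :* (y :- z) := x :* y :- x :* z) refl x y z ⟩
    x * y - x * z    ≈⟨ +-congʳ xy≈xz ⟩
    x * z - x * z    ≈⟨ -‿inverseʳ _ ⟩
    0#               ∎))

  x*y≈z⇒x≈z/y : ∀ {x y z} → y ≉ 0# → x * y ≈ z → x ≈ z / y
  x*y≈z⇒x≈z/y {x} {y} {z} y≉0 xy≈z = begin
    x                ≈⟨ *-identityʳ x ⟨
    x * 1#           ≈⟨ *-congˡ (⁻¹-inverse y y≉0) ⟨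
    x * (y * y ⁻¹)   ≈⟨ *-assoc _ _ _ ⟨
    (x * y) * y ⁻¹   ≈⟨ *-congʳ xy≈z ⟩
    z / y            ∎

  /-*-cancel : ∀ {x y} → y ≉ 0# → (x / y) * y ≈ x
  /-*-cancel {x} {y} y≉0 = begin
    (x * y ⁻¹) * y   ≈⟨ *-assoc _ _ _ ⟩
    x * (y ⁻¹ * y)   ≈⟨ *-congˡ (trans (*-comm _ _) (⁻¹-inverse y y≉0)) ⟩
    x * 1#           ≈⟨ *-identityʳ x ⟩
    x                ∎

  /-cross : ∀ {a b c d} → b ≉ 0# → d ≉ 0# → a * d ≈ c * b → a / b ≈ c / d
  /-cross {a} {b} {c} {d} b≉0 d≉0 ad≈cb = x*y≈z⇒x≈z/y d≉0 (*-cancelˡ b≉0 (begin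
    b * (a / b * d)   ≈⟨ solve 4 (λ a b d b⁻¹ → b :* (a :* b⁻¹ :* d) := (a :* b⁻¹ :* b) :* d) refl a b d (b ⁻¹) ⟩
    (a / b * b) * d   ≈⟨ *-congʳ (/-*-cancel b≉0) ⟩
    a * d             ≈⟨ ad≈cb ⟩
    c * b             ≈⟨ *-comm c b ⟩
    b * c             ∎))

  pow-+ : ∀ x m n → pow x (m ℕ.+ n) ≈ pow x m * pow x n
  pow-+ x zero    n = sym (*-identityˡ _)
  pow-+ x (suc m) n = trans (*-congˡ (pow-+ x m n)) (sym (*-assoc _ _ _))

  pow-* : ∀ x m n → pow x (m ℕ.* n) ≈ pow (pow x m) n
  pow-* x m zero    = reflexive (≡.cong (pow x) (ℕₚ.*-zeroʳ m))
  pow-* x m (suc n) = begin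
    pow x (m ℕ.* suc n)          ≡⟨ ≡.cong (pow x) (ℕₚ.*-suc m n) ⟩
    pow x (m ℕ.+ m ℕ.* n)        ≈⟨ pow-+ x m (m ℕ.* n) ⟩
    pow x m * pow x (m ℕ.* n)    ≈⟨ *-congˡ (pow-* x m n) ⟩
    pow x m * pow (pow x m) n    ∎

  pow-congˡ : ∀ {x y} n → x ≈ y → pow x n ≈ pow y n
  pow-congˡ zero    x≈y = refl
  pow-congˡ (suc n) x≈y = *-cong x≈y (pow-congˡ n x≈y)

  pow-1# : ∀ n → pow 1# n ≈ 1#
  pow-1# zero    = refl
  pow-1# (suc n) = trans (*-identityˡ _) (pow-1# n)

  pow-≉0 : ∀ {x} n → x ≉ 0# → pow x n ≉ 0#
  pow-≉0 zero    x≉0 = 1≉0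
  pow-≉0 (suc n) x≉0 = *-≉0 x≉0 (pow-≉0 n x≉0)

  -- A summand of the theorem at a node r, compared with the interpolation weight g / d at r.
  summand-rescale : ∀ {r g a b d K N W} → r ≉ 1# → W ≉ 1# → d ≉ 0# → d ≈ a * b →
                    pow (r - 1#) 4 * g ≈ K → r * a ≈ N → (r - 1#) * b ≈ W - 1# →
                    K * (r / (pow (r - 1#) 3 * (W - 1#))) ≈ N * (g / d)
  summand-rescale {r} {g} {a} {b} {d} {K} {N} {W} r≉1 W≉1 d≉0 d≈ab K≈ ra≈N r-1b≈W-1 = begin
    K * (r / B)          ≈⟨ *-assoc K r (B ⁻¹) ⟨
    (K * r) / B          ≈⟨ /-cross B≉0 d≉0 cross ⟩
    (N * g) / d          ≈⟨ *-assoc N g (d ⁻¹) ⟩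
    N * (g / d)          ∎
    where
    B : Carrier
    B = pow (r - 1#) 3 * (W - 1#)
    B≉0 : B ≉ 0#
    B≉0 = *-≉0 (pow-≉0 3 (x≉y⇒x-y≉0 r≉1)) (x≉y⇒x-y≉0 W≉1)
    cross : (K * r) * d ≈ (N * g) * B
    cross = begin
      (K * r) * d
        ≈⟨ *-cong (*-congʳ (sym K≈)) d≈ab ⟩
      (pow (r - 1#) 4 * g * r) * (a * b)
        ≈⟨ solve 5 (λ D g r a b → (D :^ 4 :* g :* r) :* (a :* b) := (r :* a :* g) :* (D :^ 3 :* (D :* b)))
                refl (r - 1#) g r a b ⟩
      (r * a * g) * (pow (r - 1#) 3 * ((r - 1#) * b))
        ≈⟨ *-cong (*-congʳ ra≈N) (*-congˡ r-1b≈W-1) ⟩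
      (N * g) * B ∎

module FiniteSums {c ℓ : Level} (F : Field c ℓ) where
  open import Data.Nat as ℕ using (zero; _<_)
  import Data.Nat.Properties as ℕₚ
  open import Relation.Nullary using (yes; no)
  import Relation.Binary.PropositionalEquality as ≡
  open ≡ using (_≢_; ≢-sym)
  open FieldProperties F

  sumBelow-cong : ∀ n {f g : ℕ → Carrier} → (∀ i → i < n → f i ≈ g i) → sumBelow n f ≈ sumBelow n g
  sumBelow-cong zero    f≈g = refl
  sumBelow-cong (suc n) f≈g = +-cong (sumBelow-cong n (λ i i<n → f≈g i (ℕₚ.m<n⇒m<1+n i<n))) (f≈g n ℕₚ.≤-refl)

  sumBelow-≈0 : ∀ n {f : ℕ → Carrier} → (∀ i → i < n → f i ≈ 0#) → sumBelow n f ≈ 0#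
  sumBelow-≈0 n {f} f≈0 = trans (sumBelow-cong n f≈0) (sumBelow-0 n)
    where
    sumBelow-0 : ∀ n → sumBelow n (λ _ → 0#) ≈ 0#
    sumBelow-0 zero    = refl
    sumBelow-0 (suc n) = trans (+-identityʳ _) (sumBelow-0 n)

  sumBelow-sucˡ : ∀ n (f : ℕ → Carrier) → sumBelow (suc n) f ≈ f 0 + sumBelow n (λ i → f (suc i))
  sumBelow-sucˡ zero    f = trans (+-identityˡ _) (sym (+-identityʳ _))
  sumBelow-sucˡ (suc n) f = trans (+-congʳ (sumBelow-sucˡ n f)) (+-assoc _ _ _)

  sumBelow-+ : ∀ m n (f : ℕ → Carrier) → sumBelow (m ℕ.+ n) f ≈ sumBelow m f + sumBelow n (λ i → f (m ℕ.+ i))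
  sumBelow-+ m zero    f = trans (reflexive (≡.cong (λ k → sumBelow k f) (ℕₚ.+-identityʳ m))) (sym (+-identityʳ _))
  sumBelow-+ m (suc n) f = begin
    sumBelow (m ℕ.+ suc n) f                                       ≡⟨ ≡.cong (λ k → sumBelow k f) (ℕₚ.+-suc m n) ⟩
    sumBelow (m ℕ.+ n) f + f (m ℕ.+ n)                             ≈⟨ +-congʳ (sumBelow-+ m n f) ⟩
    (sumBelow m f + sumBelow n (λ i → f (m ℕ.+ i))) + f (m ℕ.+ n)  ≈⟨ +-assoc _ _ _ ⟩
    sumBelow m f + sumBelow (suc n) (λ i → f (m ℕ.+ i))            ∎

  *-distribˡ-sumBelow : ∀ n x (f : ℕ → Carrier) → x * sumBelow n f ≈ sumBelow n (λ i → x * f i)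
  *-distribˡ-sumBelow zero    x f = zeroʳ x
  *-distribˡ-sumBelow (suc n) x f = trans (distribˡ _ _ _) (+-congʳ (*-distribˡ-sumBelow n x f))

  sumBelow-single : ∀ n j (f : ℕ → Carrier) → j < n → (∀ i → i < n → i ≢ j → f i ≈ 0#) → sumBelow n f ≈ f j
  sumBelow-single (suc n) j f j<1+n others≈0 with j ℕ.≟ n
  ... | yes ≡.refl = trans (+-congʳ (sumBelow-≈0 n (λ i i<n → others≈0 i (ℕₚ.m<n⇒m<1+n i<n) (ℕₚ.<⇒≢ i<n))))
                           (+-identityˡ _)
  ... | no j≢n     = trans (+-cong (sumBelow-single n j f (ℕₚ.≤∧≢⇒< (ℕₚ.≤-pred j<1+n) j≢n)
                                      (λ i i<n → others≈0 i (ℕₚ.m<n⇒m<1+n i<n)))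
                                   (others≈0 n ℕₚ.≤-refl (≢-sym j≢n)))
                           (+-identityʳ _)

module Polynomials {c ℓ : Level} (F : Field c ℓ) where
  open import Data.Nat as ℕ using (zero; _<_; _∸_; z≤n)
  import Data.Nat.Properties as ℕₚ
  open import Data.List using (List; []; _∷_; drop)
  open import Data.Product using (_×_; _,_; proj₁; proj₂)
  open import Relation.Nullary using (yes; no)
  import Relation.Binary.PropositionalEquality as ≡
  open ≡ using (_≢_)
  open FieldProperties F
  open FiniteSums F
  open NatBounds
  open import Algebra.Properties.Ring ring using (-1*x≈-x)

  -- Coefficient lists, constant term first.
  Poly : Set c
  Poly = List Carrier

  eval : Poly → Carrier → Carrier
  eval []       x = 0#
  eval (a ∷ as) x = a + x * eval as x

  coeff : Poly → ℕ → Carrier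
  coeff []       k       = 0#
  coeff (a ∷ as) zero    = a
  coeff (a ∷ as) (suc k) = coeff as k

  infixl 6 _+ₚ_ _-ₚ_
  infixl 7 _·ₚ_ _*ₚ_

  _+ₚ_ : Poly → Poly → Poly
  []       +ₚ B        = B
  (a ∷ as) +ₚ []       = a ∷ as
  (a ∷ as) +ₚ (b ∷ bs) = a + b ∷ as +ₚ bs

  _·ₚ_ : Carrier → Poly → Poly
  x ·ₚ []       = []
  x ·ₚ (a ∷ as) = x * a ∷ x ·ₚ as

  _-ₚ_ : Poly → Poly → Poly
  A -ₚ B = A +ₚ (- 1#) ·ₚ B

  _*ₚ_ : Poly → Poly → Poly
  []       *ₚ B = []
  (a ∷ as) *ₚ B = a ·ₚ B +ₚ (0# ∷ as *ₚ B)

  DegreeBelow : ℕ → Poly → Set ℓ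
  DegreeBelow n A = ∀ k → n ℕ.≤ k → coeff A k ≈ 0#

  Monic : ℕ → Poly → Set ℓ
  Monic n A = DegreeBelow (suc n) A × coeff A n ≈ 1#

  eval-cong : ∀ A {x y} → x ≈ y → eval A x ≈ eval A y
  eval-cong []       x≈y = refl
  eval-cong (a ∷ as) x≈y = +-congˡ (*-cong x≈y (eval-cong as x≈y))

  eval-+ₚ : ∀ A B x → eval (A +ₚ B) x ≈ eval A x + eval B x
  eval-+ₚ []       B        x = sym (+-identityˡ _)
  eval-+ₚ (a ∷ as) []       x = sym (+-identityʳ _)
  eval-+ₚ (a ∷ as) (b ∷ bs) x = begin
    (a + b) + x * eval (as +ₚ bs) x
      ≈⟨ +-congˡ (*-congˡ (eval-+ₚ as bs x)) ⟩
    (a + b) + x * (eval as x + eval bs x)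
      ≈⟨ solve 5 (λ a b x u v → (a :+ b) :+ x :* (u :+ v) := (a :+ x :* u) :+ (b :+ x :* v))
               refl a b x (eval as x) (eval bs x) ⟩
    (a + x * eval as x) + (b + x * eval bs x) ∎

  eval-·ₚ : ∀ y A x → eval (y ·ₚ A) x ≈ y * eval A x
  eval-·ₚ y []       x = sym (zeroʳ y)
  eval-·ₚ y (a ∷ as) x = trans (+-congˡ (*-congˡ (eval-·ₚ y as x)))
                               (solve 4 (λ y a x u → y :* a :+ x :* (y :* u) := y :* (a :+ x :* u)) refl y a x (eval as x))

  eval--ₚ : ∀ A B x → eval (A -ₚ B) x ≈ eval A x - eval B x
  eval--ₚ A B x = trans (eval-+ₚ A ((- 1#) ·ₚ B) x) (+-congˡ (trans (eval-·ₚ (- 1#) B x) (-1*x≈-x _)))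

  eval-*ₚ : ∀ A B x → eval (A *ₚ B) x ≈ eval A x * eval B x
  eval-*ₚ []       B x = sym (zeroˡ _)
  eval-*ₚ (a ∷ as) B x = begin
    eval (a ·ₚ B +ₚ (0# ∷ as *ₚ B)) x
      ≈⟨ eval-+ₚ (a ·ₚ B) (0# ∷ as *ₚ B) x ⟩
    eval (a ·ₚ B) x + (0# + x * eval (as *ₚ B) x)
      ≈⟨ +-cong (eval-·ₚ a B x) (+-congˡ (*-congˡ (eval-*ₚ as B x))) ⟩
    a * eval B x + (0# + x * (eval as x * eval B x))
      ≈⟨ solve 4 (λ a b x u → a :* b :+ (num 0 :+ x :* (u :* b)) := (a :+ x :* u) :* b) refl a (eval B x) x (eval as x) ⟩
    (a + x * eval as x) * eval B x ∎

  coeff-+ₚ : ∀ A B k → coeff (A +ₚ B) k ≈ coeff A k + coeff B k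
  coeff-+ₚ []       B        k       = sym (+-identityˡ _)
  coeff-+ₚ (a ∷ as) []       zero    = sym (+-identityʳ _)
  coeff-+ₚ (a ∷ as) []       (suc k) = sym (+-identityʳ _)
  coeff-+ₚ (a ∷ as) (b ∷ bs) zero    = refl
  coeff-+ₚ (a ∷ as) (b ∷ bs) (suc k) = coeff-+ₚ as bs k

  coeff-·ₚ : ∀ x A k → coeff (x ·ₚ A) k ≈ x * coeff A k
  coeff-·ₚ x []       k       = sym (zeroʳ x)
  coeff-·ₚ x (a ∷ as) zero    = refl
  coeff-·ₚ x (a ∷ as) (suc k) = coeff-·ₚ x as k

  coeff--ₚ : ∀ A B k → coeff (A -ₚ B) k ≈ coeff A k - coeff B k
  coeff--ₚ A B k = trans (coeff-+ₚ A ((- 1#) ·ₚ B) k) (+-congˡ (trans (coeff-·ₚ (- 1#) B k) (-1*x≈-x _)))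

  coeff-*ₚ : ∀ A B k → coeff (A *ₚ B) k ≈ sumBelow (suc k) (λ i → coeff A i * coeff B (k ∸ i))
  coeff-*ₚ []       B k       = sym (sumBelow-≈0 (suc k) (λ i _ → zeroˡ _))
  coeff-*ₚ (a ∷ as) B zero    = begin
    coeff (a ·ₚ B +ₚ (0# ∷ as *ₚ B)) zero  ≈⟨ coeff-+ₚ (a ·ₚ B) (0# ∷ as *ₚ B) zero ⟩
    coeff (a ·ₚ B) zero + 0#               ≈⟨ +-identityʳ _ ⟩
    coeff (a ·ₚ B) zero                    ≈⟨ coeff-·ₚ a B zero ⟩
    a * coeff B zero                       ≈⟨ +-identityˡ _ ⟨
    0# + a * coeff B zero                  ∎
  coeff-*ₚ (a ∷ as) B (suc k) = begin
    coeff (a ·ₚ B +ₚ (0# ∷ as *ₚ B)) (suc k)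
      ≈⟨ coeff-+ₚ (a ·ₚ B) (0# ∷ as *ₚ B) (suc k) ⟩
    coeff (a ·ₚ B) (suc k) + coeff (as *ₚ B) k
      ≈⟨ +-cong (coeff-·ₚ a B (suc k)) (coeff-*ₚ as B k) ⟩
    a * coeff B (suc k) + sumBelow (suc k) (λ i → coeff as i * coeff B (k ∸ i))
      ≈⟨ sumBelow-sucˡ (suc k) (λ i → coeff (a ∷ as) i * coeff B (suc k ∸ i)) ⟨
    sumBelow (suc (suc k)) (λ i → coeff (a ∷ as) i * coeff B (suc k ∸ i)) ∎

  coeff≈0⇒eval≈0 : ∀ A x → (∀ k → coeff A k ≈ 0#) → eval A x ≈ 0#
  coeff≈0⇒eval≈0 []       x A≈0 = refl
  coeff≈0⇒eval≈0 (a ∷ as) x A≈0 = begin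
    a + x * eval as x   ≈⟨ +-cong (A≈0 0) (*-congˡ (coeff≈0⇒eval≈0 as x (λ k → A≈0 (suc k)))) ⟩
    0# + x * 0#         ≈⟨ trans (+-identityˡ _) (zeroʳ x) ⟩
    0#                  ∎

  degree-mono : ∀ {m n} A → m ℕ.≤ n → DegreeBelow m A → DegreeBelow n A
  degree-mono A m≤n degA k n≤k = degA k (ℕₚ.≤-trans m≤n n≤k)

  degree-+ₚ : ∀ {n} A B → DegreeBelow n A → DegreeBelow n B → DegreeBelow n (A +ₚ B)
  degree-+ₚ A B degA degB k n≤k = trans (coeff-+ₚ A B k) (trans (+-cong (degA k n≤k) (degB k n≤k)) (+-identityʳ 0#))

  degree-·ₚ : ∀ {n} x A → DegreeBelow n A → DegreeBelow n (x ·ₚ A)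
  degree-·ₚ x A degA k n≤k = trans (coeff-·ₚ x A k) (trans (*-congˡ (degA k n≤k)) (zeroʳ x))

  degree--ₚ : ∀ {n} A B → DegreeBelow n A → DegreeBelow n B → DegreeBelow n (A -ₚ B)
  degree--ₚ A B degA degB = degree-+ₚ A ((- 1#) ·ₚ B) degA (degree-·ₚ (- 1#) B degB)

  private
    convolution-term≈0 : ∀ {a b} A B i k → DegreeBelow (suc a) A → DegreeBelow (suc b) B →
                         (i ℕ.≤ a → suc b ℕ.≤ k ∸ i) → coeff A i * coeff B (k ∸ i) ≈ 0#
    convolution-term≈0 {a} A B i k degA degB bound with suc a ℕ.≤? i
    ... | yes a<i = trans (*-congʳ (degA i a<i)) (zeroˡ _)
    ... | no a≮i  = trans (*-congˡ (degB (k ∸ i) (bound (ℕₚ.≤-pred (ℕₚ.≰⇒> a≮i))))) (zeroʳ _)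

  degree-*ₚ : ∀ {a b} A B → DegreeBelow (suc a) A → DegreeBelow (suc b) B → DegreeBelow (suc (a ℕ.+ b)) (A *ₚ B)
  degree-*ₚ {a} {b} A B degA degB k a+b<k =
    trans (coeff-*ₚ A B k) (sumBelow-≈0 (suc k) (λ i _ → convolution-term≈0 A B i k degA degB bound))
    where
    bound : ∀ {i} → i ℕ.≤ a → b < k ∸ i
    bound i≤a = i≤a∧a+b<k⇒b<k∸i i≤a a+b<k

  leading-*ₚ : ∀ {a b} A B → DegreeBelow (suc a) A → DegreeBelow (suc b) B →
               coeff (A *ₚ B) (a ℕ.+ b) ≈ coeff A a * coeff B b
  leading-*ₚ {a} {b} A B degA degB = begin
    coeff (A *ₚ B) (a ℕ.+ b)
      ≈⟨ coeff-*ₚ A B (a ℕ.+ b) ⟩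
    sumBelow (suc (a ℕ.+ b)) (λ i → coeff A i * coeff B (a ℕ.+ b ∸ i))
      ≈⟨ sumBelow-single (suc (a ℕ.+ b)) a _ (s≤s (ℕₚ.m≤m+n a b)) others≈0 ⟩
    coeff A a * coeff B (a ℕ.+ b ∸ a)
      ≡⟨ ≡.cong (λ j → coeff A a * coeff B j) (ℕₚ.m+n∸m≡n a b) ⟩
    coeff A a * coeff B b ∎
    where
    others≈0 : ∀ i → i < suc (a ℕ.+ b) → i ≢ a → coeff A i * coeff B (a ℕ.+ b ∸ i) ≈ 0#
    others≈0 i _ i≢a = convolution-term≈0 A B i (a ℕ.+ b) degA degB (λ i≤a → i<a⇒b<a+b∸i (ℕₚ.≤∧≢⇒< i≤a i≢a))

  monic-*ₚ : ∀ {a b} A B → Monic a A → Monic b B → Monic (a ℕ.+ b) (A *ₚ B)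
  monic-*ₚ A B (degA , lcA) (degB , lcB) =
    degree-*ₚ A B degA degB , trans (leading-*ₚ A B degA degB) (trans (*-cong lcA lcB) (*-identityʳ 1#))

  coeff-drop : ∀ j A i → coeff (drop j A) i ≡ coeff A (j ℕ.+ i)
  coeff-drop zero    A        i = ≡.refl
  coeff-drop (suc j) []       i = ≡.refl
  coeff-drop (suc j) (a ∷ as) i = coeff-drop j as i

  eval-drop : ∀ j A x → eval (drop j A) x ≈ coeff A j + x * eval (drop (suc j) A) x
  eval-drop zero    []       x = sym (trans (+-identityˡ _) (zeroʳ x))
  eval-drop zero    (a ∷ as) x = refl
  eval-drop (suc j) []       x = sym (trans (+-identityˡ _) (zeroʳ x))
  eval-drop (suc j) (a ∷ as) x = eval-drop j as x

  eval-drop-low : ∀ m A x → (∀ k → k < m → coeff A k ≈ 0#) → eval A x ≈ pow x m * eval (drop m A) x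
  eval-drop-low zero    A x _      = sym (*-identityˡ _)
  eval-drop-low (suc m) A x low≈0 = begin
    eval A x
      ≈⟨ eval-drop-low m A x (λ k k<m → low≈0 k (ℕₚ.m<n⇒m<1+n k<m)) ⟩
    pow x m * eval (drop m A) x
      ≈⟨ *-congˡ (eval-drop m A x) ⟩
    pow x m * (coeff A m + x * eval (drop (suc m) A) x) ≈⟨ *-congˡ (+-congʳ (low≈0 m ℕₚ.≤-refl)) ⟩
    pow x m * (0# + x * eval (drop (suc m) A) x)
      ≈⟨ solve 3 (λ xᵐ x d → xᵐ :* (num 0 :+ x :* d) := (x :* xᵐ) :* d) refl (pow x m) x (eval (drop (suc m) A) x) ⟩
    pow x (suc m) * eval (drop (suc m) A) x ∎

  eval-0# : ∀ A → eval A 0# ≈ coeff A 0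
  eval-0# []       = refl
  eval-0# (a ∷ as) = trans (+-congˡ (zeroˡ _)) (+-identityʳ a)

  quotient : Carrier → Poly → Poly
  quotient r []           = []
  quotient r (a ∷ [])     = []
  quotient r (a ∷ b ∷ bs) = eval (b ∷ bs) r ∷ quotient r (b ∷ bs)

  eval-quotient : ∀ r A y → eval A y ≈ eval A r + (y - r) * eval (quotient r A) y
  eval-quotient r []           y = solve 2 (λ y r → num 0 := num 0 :+ (y :- r) :* num 0) refl y r
  eval-quotient r (a ∷ [])     y = solve 3 (λ a y r → a :+ y :* num 0 := (a :+ r :* num 0) :+ (y :- r) :* num 0) refl a y r
  eval-quotient r (a ∷ b ∷ bs) y = begin
    a + y * B y
      ≈⟨ +-congˡ (*-congˡ (eval-quotient r (b ∷ bs) y)) ⟩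
    a + y * (B r + (y - r) * Q y)
      ≈⟨ solve 5 (λ a y r Br Qy → a :+ y :* (Br :+ (y :- r) :* Qy) := (a :+ r :* Br) :+ (y :- r) :* (Br :+ y :* Qy))
              refl a y r (B r) (Q y) ⟩
    (a + r * B r) + (y - r) * (B r + y * Q y) ∎
    where
    B Q : Carrier → Carrier
    B = eval (b ∷ bs)
    Q = eval (quotient r (b ∷ bs))

  coeff-quotient : ∀ r A k → coeff (quotient r A) k ≈ eval (drop (suc k) A) r
  coeff-quotient r []           k       = refl
  coeff-quotient r (a ∷ [])     zero    = refl
  coeff-quotient r (a ∷ [])     (suc k) = refl
  coeff-quotient r (a ∷ b ∷ bs) zero    = refl
  coeff-quotient r (a ∷ b ∷ bs) (suc k) = coeff-quotient r (b ∷ bs) k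

  degree-quotient : ∀ n r A → DegreeBelow (suc n) A → DegreeBelow n (quotient r A)
  degree-quotient n r A degA k n≤k = trans (coeff-quotient r A k) (coeff≈0⇒eval≈0 (drop (suc k) A) r
    (λ i → trans (reflexive (coeff-drop (suc k) A i)) (degA _ (s≤s (ℕₚ.≤-trans n≤k (ℕₚ.m≤m+n k i))))))

  Distinct : ℕ → (ℕ → Carrier) → Set ℓ
  Distinct k x = ∀ i j → i < k → j < k → i ≢ j → x i ≉ x j

  roots⇒coeff≈0 : ∀ k (x : ℕ → Carrier) A → DegreeBelow k A → Distinct k x →
                  (∀ i → i < k → eval A (x i) ≈ 0#) → ∀ m → coeff A m ≈ 0#
  roots⇒coeff≈0 zero    x A degA distinct roots m = degA m z≤n
  roots⇒coeff≈0 (suc k) x A degA distinct roots m = begin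
    coeff A m                                       ≈⟨ +-identityʳ _ ⟨
    coeff A m + 0#                                  ≈⟨ +-congˡ (trans (*-congˡ (drop-suc≈0 m)) (zeroʳ r)) ⟨
    coeff A m + r * eval (drop (suc m) A) r         ≈⟨ eval-drop m A r ⟨
    eval (drop m A) r                               ≈⟨ drop≈0 m ⟩
    0#                                              ∎
    where
    r : Carrier
    r = x 0
    Q : Poly
    Q = quotient r A

    Q-roots : ∀ i → i < k → eval Q (x (suc i)) ≈ 0#
    Q-roots i i<k = x*y≈0⇒y≈0 (x≉y⇒x-y≉0 (distinct (suc i) 0 (s≤s i<k) (s≤s z≤n) (λ ()))) (begin
      (x (suc i) - r) * eval Q (x (suc i))                ≈⟨ +-identityˡ _ ⟨
      0# + (x (suc i) - r) * eval Q (x (suc i))           ≈⟨ +-congʳ (roots 0 (s≤s z≤n)) ⟨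
      eval A r + (x (suc i) - r) * eval Q (x (suc i))     ≈⟨ eval-quotient r A (x (suc i)) ⟨
      eval A (x (suc i))                                  ≈⟨ roots (suc i) (s≤s i<k) ⟩
      0#                                                  ∎)

    Q≈0 : ∀ m → coeff Q m ≈ 0#
    Q≈0 = roots⇒coeff≈0 k (λ i → x (suc i)) Q (degree-quotient k r A degA)
            (λ i j i<k j<k i≢j → distinct (suc i) (suc j) (s≤s i<k) (s≤s j<k) (λ 1+i≡1+j → i≢j (ℕₚ.suc-injective 1+i≡1+j)))
            Q-roots

    drop-suc≈0 : ∀ m → eval (drop (suc m) A) r ≈ 0#
    drop-suc≈0 m = trans (sym (coeff-quotient r A m)) (Q≈0 m)

    drop≈0 : ∀ m → eval (drop m A) r ≈ 0#
    drop≈0 zero    = roots 0 (s≤s z≤n)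
    drop≈0 (suc m) = drop-suc≈0 m

  -- Σᵢ G(xᵢ) / Pᵢ(xᵢ) is the leading coefficient of the interpolant of G at the nodes xᵢ.
  interpolation-sum≈0 : ∀ n (x : ℕ → Carrier) (P : ℕ → Poly) (G : Poly) → Distinct (suc n) x →
                        (∀ i j → i < suc n → j < suc n → i ≢ j → eval (P i) (x j) ≈ 0#) →
                        (∀ i → i < suc n → Monic n (P i)) →
                        (∀ i → i < suc n → eval (P i) (x i) ≉ 0#) →
                        DegreeBelow n G →
                        sumBelow (suc n) (λ i → eval G (x i) / eval (P i) (x i)) ≈ 0#
  interpolation-sum≈0 n x P G distinct P-roots P-monic P≉0 degG = begin
    sumBelow (suc n) w
      ≈⟨ sumBelow-cong (suc n) (λ i i≤n → trans (sym (*-identityʳ (w i))) (*-congˡ (sym (proj₂ (P-monic i i≤n))))) ⟩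
    sumBelow (suc n) (λ i → w i * coeff (P i) n)
      ≈⟨ coeff-combination (suc n) n ⟨
    coeff L n
      ≈⟨ +-identityʳ _ ⟨
    coeff L n + 0#
      ≈⟨ +-congˡ (trans (-‿cong (degG n ℕₚ.≤-refl)) -0#≈0#) ⟨
    coeff L n - coeff G n
      ≈⟨ coeff--ₚ L G n ⟨
    coeff (L -ₚ G) n
      ≈⟨ roots⇒coeff≈0 (suc n) x (L -ₚ G) degL-G distinct L-G-roots n ⟩
    0# ∎
    where
    w : ℕ → Carrier
    w i = eval G (x i) / eval (P i) (x i)

    combination : ℕ → Poly
    combination zero    = []
    combination (suc k) = combination k +ₚ w k ·ₚ P k

    L : Poly
    L = combination (suc n)

    eval-combination : ∀ k y → eval (combination k) y ≈ sumBelow k (λ i → w i * eval (P i) y)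
    eval-combination zero    y = refl
    eval-combination (suc k) y = trans (eval-+ₚ (combination k) (w k ·ₚ P k) y) (+-cong (eval-combination k y) (eval-·ₚ (w k) (P k) y))

    coeff-combination : ∀ k t → coeff (combination k) t ≈ sumBelow k (λ i → w i * coeff (P i) t)
    coeff-combination zero    t = refl
    coeff-combination (suc k) t = trans (coeff-+ₚ (combination k) (w k ·ₚ P k) t) (+-cong (coeff-combination k t) (coeff-·ₚ (w k) (P k) t))

    degree-combination : ∀ k → k ℕ.≤ suc n → DegreeBelow (suc n) (combination k)
    degree-combination zero    _     t _ = refl
    degree-combination (suc k) k<1+n = degree-+ₚ (combination k) (w k ·ₚ P k) (degree-combination k (ℕₚ.<⇒≤ k<1+n))
                                         (degree-·ₚ (w k) (P k) (proj₁ (P-monic k k<1+n)))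

    degL-G : DegreeBelow (suc n) (L -ₚ G)
    degL-G = degree--ₚ L G (degree-combination (suc n) ℕₚ.≤-refl) (degree-mono G (ℕₚ.n≤1+n n) degG)

    L-G-roots : ∀ j → j < suc n → eval (L -ₚ G) (x j) ≈ 0#
    L-G-roots j j≤n = begin
      eval (L -ₚ G) (x j)                                    ≈⟨ eval--ₚ L G (x j) ⟩
      eval L (x j) - eval G (x j)                            ≈⟨ +-congʳ (eval-combination (suc n) (x j)) ⟩
      sumBelow (suc n) (λ i → w i * eval (P i) (x j)) - eval G (x j)
        ≈⟨ +-congʳ (sumBelow-single (suc n) j _ j≤n (λ i i≤n i≢j → trans (*-congˡ (P-roots i j i≤n j≤n i≢j)) (zeroʳ _))) ⟩
      w j * eval (P j) (x j) - eval G (x j)                  ≈⟨ +-congʳ (/-*-cancel (P≉0 j j≤n)) ⟩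
      eval G (x j) - eval G (x j)                            ≈⟨ -‿inverseʳ _ ⟩
      0#                                                     ∎

  -- geom r n = (zⁿ - rⁿ) / (z - r) = Σ_{k<n} r^(n-1-k) z^k
  geom : Carrier → ℕ → Poly
  geom r zero    = []
  geom r (suc n) = pow r n ∷ geom r n

  geom-eval : ∀ r n z → (z - r) * eval (geom r n) z ≈ pow z n - pow r n
  geom-eval r zero    z = trans (zeroʳ _) (sym (-‿inverseʳ 1#))
  geom-eval r (suc n) z = begin
    (z - r) * (pow r n + z * eval (geom r n) z)
      ≈⟨ solve 4 (λ z r rⁿ g → (z :- r) :* (rⁿ :+ z :* g) := z :* ((z :- r) :* g) :+ (z :- r) :* rⁿ)
              refl z r (pow r n) (eval (geom r n) z) ⟩
    z * ((z - r) * eval (geom r n) z) + (z - r) * pow r n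
      ≈⟨ +-congʳ (*-congˡ (geom-eval r n z)) ⟩
    z * (pow z n - pow r n) + (z - r) * pow r n
      ≈⟨ solve 4 (λ z r zⁿ rⁿ → z :* (zⁿ :- rⁿ) :+ (z :- r) :* rⁿ := z :* zⁿ :- r :* rⁿ)
              refl z r (pow z n) (pow r n) ⟩
    z * pow z n - r * pow r n ∎

  geom-self : ∀ r n → r * eval (geom r n) r ≈ nat n * pow r n
  geom-self r zero    = trans (zeroʳ r) (sym (zeroˡ _))
  geom-self r (suc n) = begin
    r * (pow r n + r * eval (geom r n) r)
      ≈⟨ distribˡ _ _ _ ⟩
    r * pow r n + r * (r * eval (geom r n) r)
      ≈⟨ +-congˡ (*-congˡ (geom-self r n)) ⟩
    r * pow r n + r * (nat n * pow r n)
      ≈⟨ solve 3 (λ r N rⁿ → r :* rⁿ :+ r :* (N :* rⁿ) := (num 1 :+ N) :* (r :* rⁿ)) refl r (nat n) (pow r n) ⟩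
    (1# + nat n) * (r * pow r n)
      ≈⟨ *-congʳ (nat-suc n) ⟨
    nat (suc n) * pow r (suc n) ∎

  geom-root : ∀ {r z} n → pow z n ≈ pow r n → z ≉ r → eval (geom r n) z ≈ 0#
  geom-root {r} {z} n zⁿ≈rⁿ z≉r = x*y≈0⇒y≈0 (x≉y⇒x-y≉0 z≉r)
    (trans (geom-eval r n z) (trans (+-congʳ zⁿ≈rⁿ) (-‿inverseʳ _)))

  geom-self≉0 : ∀ {r} n → pow r n ≈ 1# → nat n ≉ 0# → eval (geom r n) r ≉ 0#
  geom-self≉0 {r} n rⁿ≈1 n≉0 g≈0 = n≉0 (begin
    nat n                      ≈⟨ *-identityʳ _ ⟨
    nat n * 1#                 ≈⟨ *-congˡ rⁿ≈1 ⟨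
    nat n * pow r n            ≈⟨ geom-self r n ⟨
    r * eval (geom r n) r      ≈⟨ *-congˡ g≈0 ⟩
    r * 0#                     ≈⟨ zeroʳ r ⟩
    0#                         ∎)

  geom-1#≉0 : ∀ {r} n → pow r n ≉ 1# → eval (geom 1# n) r ≉ 0#
  geom-1#≉0 {r} n rⁿ≉1 g≈0 = rⁿ≉1 (begin
    pow r n                    ≈⟨ x-y≈0⇒x≈y _ _ (trans (sym (geom-eval 1# n r)) (trans (*-congˡ g≈0) (zeroʳ _))) ⟩
    pow 1# n                   ≈⟨ pow-1# n ⟩
    1#                         ∎)

  eval-geom-1#-1# : ∀ n → eval (geom 1# n) 1# ≈ nat n
  eval-geom-1#-1# n = begin
    eval (geom 1# n) 1#         ≈⟨ *-identityˡ _ ⟨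
    1# * eval (geom 1# n) 1#    ≈⟨ geom-self 1# n ⟩
    nat n * pow 1# n            ≈⟨ *-congˡ (pow-1# n) ⟩
    nat n * 1#                  ≈⟨ *-identityʳ _ ⟩
    nat n                       ∎

  eval-*ₚ-rootˡ : ∀ A B {y} → eval A y ≈ 0# → eval (A *ₚ B) y ≈ 0#
  eval-*ₚ-rootˡ A B {y} Ay≈0 = trans (eval-*ₚ A B y) (trans (*-congʳ Ay≈0) (zeroˡ _))

  eval-*ₚ-rootʳ : ∀ A B {y} → eval B y ≈ 0# → eval (A *ₚ B) y ≈ 0#
  eval-*ₚ-rootʳ A B {y} By≈0 = trans (eval-*ₚ A B y) (trans (*-congˡ By≈0) (zeroʳ _))

  monic-geom : ∀ r n → Monic n (geom r (suc n))
  monic-geom r n = degree n , leading n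
    where
    degree : ∀ n → DegreeBelow (suc n) (geom r (suc n))
    degree zero    (suc k) _         = refl
    degree (suc n) (suc k) (s≤s n≤k) = degree n k n≤k
    leading : ∀ n → coeff (geom r (suc n)) n ≈ 1#
    leading zero    = refl
    leading (suc n) = leading n

  shift : Carrier → Poly → Poly
  shift s []       = []
  shift s (a ∷ as) = (a ∷ shift s as) +ₚ s ·ₚ shift s as

  eval-shift : ∀ s A w → eval (shift s A) w ≈ eval A (s + w)
  eval-shift s []       w = refl
  eval-shift s (a ∷ as) w = begin
    eval ((a ∷ S) +ₚ s ·ₚ S) w
      ≈⟨ eval-+ₚ (a ∷ S) (s ·ₚ S) w ⟩
    (a + w * eval S w) + eval (s ·ₚ S) w
      ≈⟨ +-congˡ (eval-·ₚ s S w) ⟩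
    (a + w * eval S w) + s * eval S w
      ≈⟨ solve 4 (λ a w s u → (a :+ w :* u) :+ s :* u := a :+ (s :+ w) :* u) refl a w s (eval S w) ⟩
    a + (s + w) * eval S w
      ≈⟨ +-congˡ (*-congˡ (eval-shift s as w)) ⟩
    a + (s + w) * eval as (s + w) ∎
    where
    S : Poly
    S = shift s as

  coeff-shift-zero : ∀ s a as → coeff (shift s (a ∷ as)) 0 ≈ a + s * coeff (shift s as) 0
  coeff-shift-zero s a as = trans (coeff-+ₚ (a ∷ shift s as) (s ·ₚ shift s as) 0) (+-congˡ (coeff-·ₚ s (shift s as) 0))

  coeff-shift-suc : ∀ s a as k → coeff (shift s (a ∷ as)) (suc k) ≈ coeff (shift s as) k + s * coeff (shift s as) (suc k)
  coeff-shift-suc s a as k = trans (coeff-+ₚ (a ∷ shift s as) (s ·ₚ shift s as) (suc k)) (+-congˡ (coeff-·ₚ s (shift s as) (suc k)))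

  degree-shift : ∀ n s A → DegreeBelow n A → DegreeBelow n (shift s A)
  degree-shift n       s []       degA = λ _ _ → refl
  degree-shift zero    s (a ∷ as) degA = degree-+ₚ (a ∷ S) (s ·ₚ S) a∷S (degree-·ₚ s S degS)
    where
    S : Poly
    S = shift s as
    degS : DegreeBelow 0 S
    degS = degree-shift 0 s as (λ k _ → degA (suc k) z≤n)
    a∷S : DegreeBelow 0 (a ∷ S)
    a∷S zero    _ = degA 0 z≤n
    a∷S (suc k) _ = degS k z≤n
  degree-shift (suc n) s (a ∷ as) degA = degree-+ₚ (a ∷ S) (s ·ₚ S) a∷S (degree-mono (s ·ₚ S) (ℕₚ.n≤1+n n) (degree-·ₚ s S degS))
    where
    S : Poly
    S = shift s as
    degS : DegreeBelow n S
    degS = degree-shift n s as (λ k n≤k → degA (suc k) (s≤s n≤k))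
    a∷S : DegreeBelow (suc n) (a ∷ S)
    a∷S (suc k) (s≤s n≤k) = degS k n≤k

module FallingFactorials {c ℓ : Level} (F : Field c ℓ) where
  open import Data.Nat as ℕ using (zero; _!)
  open FieldProperties F
  open Polynomials F

  falling : Carrier → ℕ → Carrier
  falling x zero    = 1#
  falling x (suc k) = falling x k * (x - nat k)

  falling-congˡ : ∀ {x y} k → x ≈ y → falling x k ≈ falling y k
  falling-congˡ zero    x≈y = refl
  falling-congˡ (suc k) x≈y = *-cong (falling-congˡ k x≈y) (+-congʳ x≈y)

  falling-0# : ∀ k → falling 0# (suc k) ≈ 0#
  falling-0# zero    = trans (*-identityˡ _) (-‿inverseʳ 0#)
  falling-0# (suc k) = trans (*-congʳ (falling-0# k)) (zeroˡ _)

  falling-1+ : ∀ x k → falling (1# + x) (suc k) ≈ (1# + x) * falling x k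
  falling-1+ x zero    = solve 1 (λ x → num 1 :* ((num 1 :+ x) :- num 0) := (num 1 :+ x) :* num 1) refl x
  falling-1+ x (suc k) = begin
    falling (1# + x) (suc k) * (1# + x - nat (suc k))
      ≈⟨ *-cong (falling-1+ x k) (+-congˡ (-‿cong (nat-suc k))) ⟩
    ((1# + x) * falling x k) * (1# + x - (1# + nat k))
      ≈⟨ solve 3 (λ x f k → ((num 1 :+ x) :* f) :* (num 1 :+ x :- (num 1 :+ k))
                  := (num 1 :+ x) :* (f :* (x :- k))) refl x (falling x k) (nat k) ⟩
    (1# + x) * (falling x k * (x - nat k)) ∎

  -- (k + 1)! [wᵏ] ((1 + w)ⁿ - 1) / w  =  n (n - 1) ⋯ (n - k)
  falling-taylor : ∀ n k → nat (suc k !) * coeff (shift 1# (geom 1# n)) k ≈ falling (nat n) (suc k)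
  falling-taylor zero    k       = trans (zeroʳ _) (sym (falling-0# k))
  falling-taylor (suc n) zero    = begin
    nat 1 * b (suc n) 0
      ≈⟨ *-identityˡ _ ⟩
    b (suc n) 0
      ≈⟨ coeff-shift-zero 1# (pow 1# n) (geom 1# n) ⟩
    pow 1# n + 1# * b n 0
      ≈⟨ +-congʳ (pow-1# n) ⟩
    1# + nat 1 * b n 0
      ≈⟨ +-congˡ (falling-taylor n 0) ⟩
    1# + falling (nat n) 1
      ≈⟨ solve 1 (λ N → num 1 :+ num 1 :* (N :- num 0) := num 1 :* ((num 1 :+ N) :- num 0)) refl (nat n) ⟩
    falling (1# + nat n) 1
      ≈⟨ falling-congˡ 1 (nat-suc n) ⟨
    falling (nat (suc n)) 1 ∎
    where
    b : ℕ → ℕ → Carrier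
    b n k = coeff (shift 1# (geom 1# n)) k
  falling-taylor (suc n) (suc k) = begin
    nat [2+k]! * b (suc n) (suc k)
      ≈⟨ *-congˡ (coeff-shift-suc 1# (pow 1# n) (geom 1# n) k) ⟩
    nat [2+k]! * (b n k + 1# * b n (suc k))
      ≈⟨ solve 3 (λ m u v → m :* (u :+ num 1 :* v) := m :* u :+ m :* v) refl (nat [2+k]!) (b n k) (b n (suc k)) ⟩
    nat [2+k]! * b n k + nat [2+k]! * b n (suc k)
      ≈⟨ +-congʳ (trans (*-congʳ (nat-* (suc (suc k)) (suc k !))) (*-assoc _ _ _)) ⟩
    nat (suc (suc k)) * (nat (suc k !) * b n k) + nat [2+k]! * b n (suc k)
      ≈⟨ +-cong (*-congˡ (falling-taylor n k)) (falling-taylor n (suc k)) ⟩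
    (1# + nat (suc k)) * falling N (suc k) + falling N (suc k) * (N - nat (suc k))
      ≈⟨ solve 3 (λ a f N → (num 1 :+ a) :* f :+ f :* (N :- a) := (num 1 :+ N) :* f)
              refl (nat (suc k)) (falling N (suc k)) N ⟩
    (1# + N) * falling N (suc k)
      ≈⟨ falling-1+ N (suc k) ⟨
    falling (1# + N) (suc (suc k))
      ≈⟨ falling-congˡ (suc (suc k)) (nat-suc n) ⟨
    falling (nat (suc n)) (suc (suc k)) ∎
    where
    N : Carrier
    N = nat n
    [2+k]! : ℕ
    [2+k]! = suc (suc k) !
    b : ℕ → ℕ → Carrier
    b n k = coeff (shift 1# (geom 1# n)) k

  shift-geom-0 : ∀ n → coeff (shift 1# (geom 1# n)) 0 ≈ nat n
  shift-geom-0 n = begin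
    b                          ≈⟨ *-identityˡ b ⟨
    nat 1 * b                  ≈⟨ falling-taylor n 0 ⟩
    1# * (nat n - 0#)          ≈⟨ solve 1 (λ N → num 1 :* (N :- num 0) := N) refl (nat n) ⟩
    nat n                      ∎
    where
    b : Carrier
    b = coeff (shift 1# (geom 1# n)) 0

module TruncatedInverse {c ℓ : Level} (F : Field c ℓ) where
  open import Data.Nat as ℕ using (zero; _<_; z≤n)
  open import Data.List using ([]; _∷_; drop)
  open import Data.Vec using ([]; _∷_)
  open import Data.Vec.Relation.Binary.Pointwise.Inductive using ([]; _∷_)
  open import Data.Fin using (#_)
  open FieldProperties F
  open Polynomials F

  -- the coefficient of w⁴ in approxInverse E · E, in terms of the coefficients e₀, …, e₄ of E
  Ψ : ∀ {m} → (E₀ E₁ E₂ E₃ E₄ : Polynomial m) → Polynomial m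
  Ψ E₀ E₁ E₂ E₃ E₄ = E₄ :* E₀ :^ 3 :- (num 2 :* E₁ :* E₃ :+ E₂ :* E₂) :* E₀ :^ 2
                     :+ num 3 :* E₁ :* E₁ :* E₂ :* E₀ :- E₁ :^ 4

  ψ : (ℕ → Carrier) → Carrier
  ψ x = ⟦ Ψ (var (# 0)) (var (# 1)) (var (# 2)) (var (# 3)) (var (# 4)) ⟧ (x 0 ∷ x 1 ∷ x 2 ∷ x 3 ∷ x 4 ∷ [])

  ψ-cong : ∀ {x y} → (∀ k → x k ≈ y k) → ψ x ≈ ψ y
  ψ-cong x≈y = ⟦⟧-cong (Ψ (var (# 0)) (var (# 1)) (var (# 2)) (var (# 3)) (var (# 4)))
                       (x≈y 0 ∷ x≈y 1 ∷ x≈y 2 ∷ x≈y 3 ∷ x≈y 4 ∷ [])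

  module _ (E : Poly) where
    private
      e : ℕ → Carrier
      e = coeff E

    -- e₀⁴ / E(w) truncated after w³
    approxInverse : Poly
    approxInverse = e 0 * e 0 * e 0
                  ∷ - (e 1 * (e 0 * e 0))
                  ∷ (e 1 * e 1 - e 0 * e 2) * e 0
                  ∷ - (e 1 * e 1 * e 1 - nat 2 * (e 0 * e 1 * e 2) + e 0 * e 0 * e 3)
                  ∷ []

    defect : Poly
    defect = drop 4 ((pow (e 0) 4 ∷ []) -ₚ approxInverse *ₚ E)

    private
      A : Poly
      A = (pow (e 0) 4 ∷ []) -ₚ approxInverse *ₚ E

      coeff-A : ∀ k → coeff A k ≈ coeff (pow (e 0) 4 ∷ []) k - sumBelow (suc k) (λ i → coeff approxInverse i * e (k ℕ.∸ i))
      coeff-A k = trans (coeff--ₚ (pow (e 0) 4 ∷ []) (approxInverse *ₚ E) k) (+-congˡ (-‿cong (coeff-*ₚ approxInverse E k)))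

      low-coeff≈0 : ∀ k → k < 4 → coeff A k ≈ 0#
      low-coeff≈0 0 _ = trans (coeff-A 0) (solve 1 (λ E₀ →
        E₀ :^ 4 :- (num 0 :+ E₀ :* E₀ :* E₀ :* E₀) := num 0) refl (e 0))
      low-coeff≈0 1 _ = trans (coeff-A 1) (solve 2 (λ E₀ E₁ →
        num 0 :- ((num 0 :+ E₀ :* E₀ :* E₀ :* E₁) :+ :- (E₁ :* (E₀ :* E₀)) :* E₀) := num 0) refl (e 0) (e 1))
      low-coeff≈0 2 _ = trans (coeff-A 2) (solve 3 (λ E₀ E₁ E₂ →
        num 0 :- (((num 0 :+ E₀ :* E₀ :* E₀ :* E₂) :+ :- (E₁ :* (E₀ :* E₀)) :* E₁) :+ (E₁ :* E₁ :- E₀ :* E₂) :* E₀ :* E₀)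
        := num 0) refl (e 0) (e 1) (e 2))
      low-coeff≈0 3 _ = trans (coeff-A 3) (solve 4 (λ E₀ E₁ E₂ E₃ →
        num 0 :- ((((num 0 :+ E₀ :* E₀ :* E₀ :* E₃) :+ :- (E₁ :* (E₀ :* E₀)) :* E₂) :+ (E₁ :* E₁ :- E₀ :* E₂) :* E₀ :* E₁)
                       :+ :- (E₁ :* E₁ :* E₁ :- num 2 :* (E₀ :* E₁ :* E₂) :+ E₀ :* E₀ :* E₃) :* E₀)
        := num 0) refl (e 0) (e 1) (e 2) (e 3))
      low-coeff≈0 (suc (suc (suc (suc k)))) (s≤s (s≤s (s≤s (s≤s ()))))

    eval-defect : ∀ w → pow w 4 * eval defect w ≈ pow (e 0) 4 - eval approxInverse w * eval E w
    eval-defect w = begin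
      pow w 4 * eval defect w
        ≈⟨ eval-drop-low 4 A w low-coeff≈0 ⟨
      eval A w
        ≈⟨ eval--ₚ (pow (e 0) 4 ∷ []) (approxInverse *ₚ E) w ⟩
      (pow (e 0) 4 + w * 0#) - eval (approxInverse *ₚ E) w
        ≈⟨ +-cong (trans (+-congˡ (zeroʳ w)) (+-identityʳ _)) (-‿cong (eval-*ₚ approxInverse E w)) ⟩
      pow (e 0) 4 - eval approxInverse w * eval E w ∎

    eval-defect-0# : eval defect 0# ≈ - ψ e
    eval-defect-0# = begin
      eval defect 0#        ≈⟨ eval-0# defect ⟩
      coeff defect 0        ≡⟨ coeff-drop 4 A 0 ⟩
      coeff A 4             ≈⟨ coeff-A 4 ⟩
      0# - sumBelow 5 (λ i → coeff approxInverse i * e (4 ℕ.∸ i))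
                            ≈⟨ solve 5 (λ E₀ E₁ E₂ E₃ E₄ →
                                 num 0 :- (((((num 0 :+ E₀ :* E₀ :* E₀ :* E₄) :+ :- (E₁ :* (E₀ :* E₀)) :* E₃)
                                                  :+ (E₁ :* E₁ :- E₀ :* E₂) :* E₀ :* E₂)
                                                 :+ :- (E₁ :* E₁ :* E₁ :- num 2 :* (E₀ :* E₁ :* E₂) :+ E₀ :* E₀ :* E₃) :* E₁)
                                                :+ num 0 :* E₀)
                                 := :- Ψ E₀ E₁ E₂ E₃ E₄) refl (e 0) (e 1) (e 2) (e 3) (e 4) ⟩
      - ψ e                 ∎

    degree-defect : ∀ n → DegreeBelow (suc n) E → DegreeBelow n defect
    degree-defect n degE k n≤k = trans (reflexive (coeff-drop 4 A k)) (degA (4 ℕ.+ k) (s≤s (s≤s (s≤s (s≤s n≤k)))))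
      where
      degT : DegreeBelow 4 approxInverse
      degT (suc (suc (suc (suc k)))) _ = refl
      degT (suc zero)                (s≤s ())
      degT (suc (suc zero))          (s≤s (s≤s ()))
      degT (suc (suc (suc zero)))    (s≤s (s≤s (s≤s ())))
      degA : DegreeBelow (4 ℕ.+ n) A
      degA = degree--ₚ (pow (e 0) 4 ∷ []) (approxInverse *ₚ E)
               (degree-mono (pow (e 0) 4 ∷ []) (s≤s z≤n) (λ { (suc k) _ → refl }))
               (degree-*ₚ approxInverse E degT degE)

module QuarticIdentity {c ℓ : Level} (F : Field c ℓ) where
  open import Data.Nat as ℕ using (zero; _!; _∸_)
  import Data.Integer as ℤ
  open import Data.Vec using ([]; _∷_)
  open import Data.Vec.Relation.Binary.Pointwise.Inductive using ([]; _∷_)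
  open import Data.Fin using (#_)
  open FieldProperties F
  open Polynomials F
  open FallingFactorials F
  open TruncatedInverse F

  -- 720 · Ψ of the product of Σ Aₖ wᵏ / (k + 1)! and Σ Bₖ wᵏ / (k + 1)!, expanded.
  Ψ-scaled : ∀ {m} → (A₀ A₁ A₂ A₃ A₄ B₀ B₁ B₂ B₃ B₄ : Polynomial m) → Polynomial m
  Ψ-scaled A₀ A₁ A₂ A₃ A₄ B₀ B₁ B₂ B₃ B₄ =
      num 90 :* A₀ :* A₁ :^ 2 :* A₂ :* B₀ :^ 4     :- num 45 :* A₀ :* A₁ :^ 3 :* B₀ :^ 3 :* B₁
    :+ num 60 :* A₀ :^ 2 :* A₁ :* A₂ :* B₀ :^ 3 :* B₁ :- num 30 :* A₀ :^ 2 :* A₁ :* A₃ :* B₀ :^ 4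
    :- num 45 :* A₀ :^ 2 :* A₁ :^ 2 :* B₀ :^ 2 :* B₁ :^ 2
    :+ num 30 :* A₀ :^ 2 :* A₁ :^ 2 :* B₀ :^ 3 :* B₂ :- num 20 :* A₀ :^ 2 :* A₂ :^ 2 :* B₀ :^ 4
    :- num 45 :* A₀ :^ 3 :* A₁ :* B₀ :* B₁ :^ 3    :+ num 60 :* A₀ :^ 3 :* A₁ :* B₀ :^ 2 :* B₁ :* B₂
    :- num 15 :* A₀ :^ 3 :* A₁ :* B₀ :^ 3 :* B₃    :+ num 30 :* A₀ :^ 3 :* A₂ :* B₀ :^ 2 :* B₁ :^ 2
    :- num 20 :* A₀ :^ 3 :* A₂ :* B₀ :^ 3 :* B₂    :- num 15 :* A₀ :^ 3 :* A₃ :* B₀ :^ 3 :* B₁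
    :+ num 6 :* A₀ :^ 3 :* A₄ :* B₀ :^ 4           :+ num 90 :* A₀ :^ 4 :* B₀ :* B₁ :^ 2 :* B₂
    :- num 30 :* A₀ :^ 4 :* B₀ :^ 2 :* B₁ :* B₃    :- num 20 :* A₀ :^ 4 :* B₀ :^ 2 :* B₂ :^ 2
    :+ num 6 :* A₀ :^ 4 :* B₀ :^ 3 :* B₄           :- num 45 :* A₀ :^ 4 :* B₁ :^ 4
    :- num 45 :* A₁ :^ 4 :* B₀ :^ 4

  ψ-scaled : (a b : ℕ → Carrier) → Carrier
  ψ-scaled a b = ⟦ Ψ-scaled (var (# 0)) (var (# 1)) (var (# 2)) (var (# 3)) (var (# 4))
                            (var (# 5)) (var (# 6)) (var (# 7)) (var (# 8)) (var (# 9)) ⟧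
                 (a 0 ∷ a 1 ∷ a 2 ∷ a 3 ∷ a 4 ∷ b 0 ∷ b 1 ∷ b 2 ∷ b 3 ∷ b 4 ∷ [])

  ψ-scaled-cong : ∀ {a a′ b b′} → (∀ k → a k ≈ a′ k) → (∀ k → b k ≈ b′ k) → ψ-scaled a b ≈ ψ-scaled a′ b′
  ψ-scaled-cong a≈ b≈ = ⟦⟧-cong (Ψ-scaled (var (# 0)) (var (# 1)) (var (# 2)) (var (# 3)) (var (# 4))
                                          (var (# 5)) (var (# 6)) (var (# 7)) (var (# 8)) (var (# 9)))
                          (a≈ 0 ∷ a≈ 1 ∷ a≈ 2 ∷ a≈ 3 ∷ a≈ 4 ∷ b≈ 0 ∷ b≈ 1 ∷ b≈ 2 ∷ b≈ 3 ∷ b≈ 4 ∷ [])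

  convolution : (ℕ → Carrier) → (ℕ → Carrier) → ℕ → Carrier
  convolution u v k = sumBelow (suc k) (λ i → u i * v (k ∸ i))

  ψ-convolution : ∀ u v → nat 720 * ψ (convolution u v) ≈ ψ-scaled (λ k → nat (suc k !) * u k) (λ k → nat (suc k !) * v k)
  ψ-convolution u v = solve 10 (λ U₀ U₁ U₂ U₃ U₄ V₀ V₁ V₂ V₃ V₄ →
    let C₀ = num 0 :+ U₀ :* V₀
        C₁ = num 0 :+ U₀ :* V₁ :+ U₁ :* V₀
        C₂ = num 0 :+ U₀ :* V₂ :+ U₁ :* V₁ :+ U₂ :* V₀
        C₃ = num 0 :+ U₀ :* V₃ :+ U₁ :* V₂ :+ U₂ :* V₁ :+ U₃ :* V₀
        C₄ = num 0 :+ U₀ :* V₄ :+ U₁ :* V₃ :+ U₂ :* V₂ :+ U₃ :* V₁ :+ U₄ :* V₀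
    in num 720 :* Ψ C₀ C₁ C₂ C₃ C₄
       := Ψ-scaled (num 1 :* U₀) (num 2 :* U₁) (num 6 :* U₂) (num 24 :* U₃) (num 120 :* U₄)
                   (num 1 :* V₀) (num 2 :* V₁) (num 6 :* V₂) (num 24 :* V₃) (num 120 :* V₄))
    refl (u 0) (u 1) (u 2) (u 3) (u 4) (v 0) (v 1) (v 2) (v 3) (v 4)

  fallingₚ : ∀ {m} → Polynomial m → ℕ → Polynomial m
  fallingₚ X zero    = num 1
  fallingₚ X (suc k) = fallingₚ X k :* (X :- num k)

  rhsValue : Carrier → Carrier → Carrier
  rhsValue x y = pow x 4 + pow y 4 - nat 5 * (pow x 2 * pow y 2) - nat 15 * (pow x 2 * y)
                 - nat 15 * (x * pow y 2) + nat 15 * x + nat 15 * y + nat 3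

  ψ-scaled-falling : ∀ x y → ψ-scaled (λ k → falling y (suc k)) (λ k → falling x (suc k)) ≈ pow (y * x) 4 * rhsValue x y
  ψ-scaled-falling x y = solve 2 (λ X Y →
    Ψ-scaled (fallingₚ Y 1) (fallingₚ Y 2) (fallingₚ Y 3) (fallingₚ Y 4) (fallingₚ Y 5)
             (fallingₚ X 1) (fallingₚ X 2) (fallingₚ X 3) (fallingₚ X 4) (fallingₚ X 5)
    := (Y :* X) :^ 4 :* (X :^ 4 :+ Y :^ 4 :- num 5 :* (X :^ 2 :* Y :^ 2) :- num 15 :* (X :^ 2 :* Y)
                         :- num 15 :* (X :* Y :^ 2) :+ num 15 :* X :+ num 15 :* Y :+ num 3))
    refl x y

  ψ-taylor : ∀ p q → nat 720 * ψ (coeff (shift 1# (geom 1# q) *ₚ shift 1# (geom 1# p)))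
                      ≈ pow (nat q * nat p) 4 * rhsValue (nat p) (nat q)
  ψ-taylor p q = begin
    nat 720 * ψ (coeff (U *ₚ V))
      ≈⟨ *-congˡ (ψ-cong (coeff-*ₚ U V)) ⟩
    nat 720 * ψ (convolution (coeff U) (coeff V))
      ≈⟨ ψ-convolution (coeff U) (coeff V) ⟩
    ψ-scaled (λ k → nat (suc k !) * coeff U k) (λ k → nat (suc k !) * coeff V k)
      ≈⟨ ψ-scaled-cong (falling-taylor q) (falling-taylor p) ⟩
    ψ-scaled (λ k → falling (nat q) (suc k)) (λ k → falling (nat p) (suc k))
      ≈⟨ ψ-scaled-falling (nat p) (nat q) ⟩
    pow (nat q * nat p) 4 * rhsValue (nat p) (nat q) ∎
    where
    U V : Poly
    U = shift 1# (geom 1# q)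
    V = shift 1# (geom 1# p)

  int-- : ∀ i j → int (i ℤ.- j) ≈ int i - int j
  int-- i j = trans (int-+ i (ℤ.- j)) (+-congˡ (int-neg j))

  int-^ : ∀ i n → int (i ℤ.^ n) ≈ pow (int i) n
  int-^ i zero    = refl
  int-^ i (suc n) = trans (int-* i (i ℤ.^ n)) (*-congˡ (int-^ i n))

  int-rhsPoly : ∀ p q → int (rhsPoly p q) ≈ rhsValue (nat p) (nat q)
  int-rhsPoly p q = trans (int-+ a₆ (ℤ.+ 3)) (+-congʳ h₆)
    where
    P Q : ℤ.ℤ
    P = ℤ.+ p
    Q = ℤ.+ q
    x y : Carrier
    x = nat p
    y = nat q
    a₁ a₂ a₃ a₄ a₅ a₆ : ℤ.ℤ
    a₁ = P ℤ.^ 4 ℤ.+ Q ℤ.^ 4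
    a₂ = a₁ ℤ.- ℤ.+ 5 ℤ.* (P ℤ.^ 2 ℤ.* Q ℤ.^ 2)
    a₃ = a₂ ℤ.- ℤ.+ 15 ℤ.* (P ℤ.^ 2 ℤ.* Q)
    a₄ = a₃ ℤ.- ℤ.+ 15 ℤ.* (P ℤ.* Q ℤ.^ 2)
    a₅ = a₄ ℤ.+ ℤ.+ 15 ℤ.* P
    a₆ = a₅ ℤ.+ ℤ.+ 15 ℤ.* Q
    h₁ : int a₁ ≈ pow x 4 + pow y 4
    h₁ = trans (int-+ (P ℤ.^ 4) (Q ℤ.^ 4)) (+-cong (int-^ P 4) (int-^ Q 4))
    h₂ : int a₂ ≈ pow x 4 + pow y 4 - nat 5 * (pow x 2 * pow y 2)
    h₂ = trans (int-- a₁ (ℤ.+ 5 ℤ.* (P ℤ.^ 2 ℤ.* Q ℤ.^ 2)))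
               (+-cong h₁ (-‿cong (trans (int-* (ℤ.+ 5) (P ℤ.^ 2 ℤ.* Q ℤ.^ 2))
                                         (*-congˡ (trans (int-* (P ℤ.^ 2) (Q ℤ.^ 2)) (*-cong (int-^ P 2) (int-^ Q 2)))))))
    h₃ : int a₃ ≈ pow x 4 + pow y 4 - nat 5 * (pow x 2 * pow y 2) - nat 15 * (pow x 2 * y)
    h₃ = trans (int-- a₂ (ℤ.+ 15 ℤ.* (P ℤ.^ 2 ℤ.* Q)))
               (+-cong h₂ (-‿cong (trans (int-* (ℤ.+ 15) (P ℤ.^ 2 ℤ.* Q))
                                         (*-congˡ (trans (int-* (P ℤ.^ 2) Q) (*-congʳ (int-^ P 2)))))))
    h₄ : int a₄ ≈ pow x 4 + pow y 4 - nat 5 * (pow x 2 * pow y 2) - nat 15 * (pow x 2 * y) - nat 15 * (x * pow y 2)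
    h₄ = trans (int-- a₃ (ℤ.+ 15 ℤ.* (P ℤ.* Q ℤ.^ 2)))
               (+-cong h₃ (-‿cong (trans (int-* (ℤ.+ 15) (P ℤ.* Q ℤ.^ 2))
                                         (*-congˡ (trans (int-* P (Q ℤ.^ 2)) (*-congˡ (int-^ Q 2)))))))
    h₅ : int a₅ ≈ pow x 4 + pow y 4 - nat 5 * (pow x 2 * pow y 2) - nat 15 * (pow x 2 * y) - nat 15 * (x * pow y 2)
                  + nat 15 * x
    h₅ = trans (int-+ a₄ (ℤ.+ 15 ℤ.* P)) (+-cong h₄ (int-* (ℤ.+ 15) P))
    h₆ : int a₆ ≈ pow x 4 + pow y 4 - nat 5 * (pow x 2 * pow y 2) - nat 15 * (pow x 2 * y) - nat 15 * (x * pow y 2)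
                  + nat 15 * x + nat 15 * y
    h₆ = trans (int-+ a₅ (ℤ.+ 15 ℤ.* Q)) (+-cong h₅ (int-* (ℤ.+ 15) Q))

module RootsOfUnity {c ℓ : Level} (F : Field c ℓ) where
  open import Data.Nat as ℕ using (_<_; _∸_)
  import Data.Nat.Properties as ℕₚ
  open import Data.Nat.GCD using (GCD; gcd-GCD; module Bézout)
  import Relation.Binary.PropositionalEquality as ≡
  open ≡ using (_≢_)
  open import Relation.Binary.Definitions using (tri<; tri≈; tri>)
  open import Relation.Nullary using (contradiction)
  open FieldProperties F

  pow-comm : ∀ x m n → pow (pow x m) n ≈ pow (pow x n) m
  pow-comm x m n = trans (sym (pow-* x m n)) (trans (reflexive (≡.cong (pow x) (ℕₚ.*-comm m n))) (pow-* x n m))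

  pow-root : ∀ {x} N k → pow x N ≈ 1# → pow (pow x k) N ≈ 1#
  pow-root {x} N k xᴺ≈1 = trans (pow-comm x k N) (trans (pow-congˡ k xᴺ≈1) (pow-1# k))

  pow-multiple : ∀ {x} N k → pow x N ≈ 1# → pow x (k ℕ.* N) ≈ 1#
  pow-multiple {x} N k xᴺ≈1 = trans (pow-* x k N) (pow-root N k xᴺ≈1)

  consecutive-powers≈1 : ∀ {y s t} → suc s ≡ t → pow y s ≈ 1# → pow y t ≈ 1# → y ≈ 1#
  consecutive-powers≈1 {y} {s} {t} 1+s≡t yˢ≈1 yᵗ≈1 = begin
    y             ≈⟨ *-identityʳ y ⟨
    y * 1#        ≈⟨ *-congˡ yˢ≈1 ⟨
    pow y (suc s) ≡⟨ ≡.cong (pow y) 1+s≡t ⟩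
    pow y t       ≈⟨ yᵗ≈1 ⟩
    1#            ∎

  coprime-roots : ∀ {m n y} → gcd m n ≡ 1 → pow y m ≈ 1# → pow y n ≈ 1# → y ≈ 1#
  coprime-roots {m} {n} {y} coprime yᵐ≈1 yⁿ≈1 with Bézout.identity (≡.subst (GCD m n) coprime (gcd-GCD m n))
  ... | Bézout.+- a b 1+bn≡am = consecutive-powers≈1 1+bn≡am (pow-multiple n b yⁿ≈1) (pow-multiple m a yᵐ≈1)
  ... | Bézout.-+ a b 1+am≡bn = consecutive-powers≈1 1+am≡bn (pow-multiple m a yᵐ≈1) (pow-multiple n b yⁿ≈1)

  module _ {N ζ} (ζ-primitive : PrimitiveRoot N ζ) where
    open PrimitiveRoot ζ-primitive

    private
      pow-injective-< : ∀ {i j} → i < j → j < N → pow ζ i ≉ pow ζ j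
      pow-injective-< {i} {j} i<j j<N ζⁱ≈ζʲ = minimal (i ℕ.+ (N ∸ j)) 0<k k<N (begin
        pow ζ (i ℕ.+ (N ∸ j))          ≈⟨ pow-+ ζ i (N ∸ j) ⟩
        pow ζ i * pow ζ (N ∸ j)        ≈⟨ *-congʳ ζⁱ≈ζʲ ⟩
        pow ζ j * pow ζ (N ∸ j)        ≈⟨ pow-+ ζ j (N ∸ j) ⟨
        pow ζ (j ℕ.+ (N ∸ j))          ≡⟨ ≡.cong (pow ζ) (ℕₚ.m+[n∸m]≡n (ℕₚ.<⇒≤ j<N)) ⟩
        pow ζ N                        ≈⟨ root ⟩
        1#                             ∎)
        where
        0<k : 1 ℕ.≤ i ℕ.+ (N ∸ j)
        0<k = ℕₚ.≤-trans (ℕₚ.m<n⇒0<n∸m j<N) (ℕₚ.m≤n+m (N ∸ j) i)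
        k<N : i ℕ.+ (N ∸ j) < N
        k<N = ≡.subst (i ℕ.+ (N ∸ j) <_) (ℕₚ.m+[n∸m]≡n (ℕₚ.<⇒≤ j<N)) (ℕₚ.+-monoˡ-< (N ∸ j) i<j)

    pow-injective : ∀ {i j} → i < N → j < N → i ≢ j → pow ζ i ≉ pow ζ j
    pow-injective {i} {j} i<N j<N i≢j with ℕₚ.<-cmp i j
    ... | tri< i<j _ _ = pow-injective-< i<j j<N
    ... | tri≈ _ i≡j _ = contradiction i≡j i≢j
    ... | tri> _ _ j<i = λ ζⁱ≈ζʲ → pow-injective-< j<i i<N (sym ζⁱ≈ζʲ)


module CoprimeRootSums {c ℓ : Level} (F : Field c ℓ) (charZero : FieldOps.CharZero F) (p′ q′ : ℕ)
                (coprime : gcd (suc p′) (suc q′) ≡ 1) (ω ξ : Field.Carrier F)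
                (ω-primitive : FieldOps.PrimitiveRoot F (suc p′) ω)
                (ξ-primitive : FieldOps.PrimitiveRoot F (suc q′) ξ) where
  open import Data.Nat as ℕ using (zero; _<_; z≤n)
  import Data.Nat.Properties as ℕₚ
  open import Data.Product using (proj₁)
  import Relation.Binary.PropositionalEquality as ≡
  open ≡ using (_≢_; ≢-sym)
  open import Function using (_∘_)
  open FieldProperties F
  open FiniteSums F
  open Polynomials F
  open FallingFactorials F using (shift-geom-0)
  open TruncatedInverse F
  open QuarticIdentity F using (ψ-taylor; rhsValue; int-rhsPoly)
  open RootsOfUnity F
  open Concatenation

  p q n : ℕ
  p = suc p′
  q = suc q′
  n = q′ ℕ.+ p′

  -- E(w) = ((1 + w)^q - 1) ((1 + w)^p - 1) / w²
  E : Poly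
  E = shift 1# (geom 1# q) *ₚ shift 1# (geom 1# p)

  K : Carrier
  K = pow (coeff E 0) 4

  G : Poly
  G = shift (- 1#) (defect E)

  coeff-E-0 : coeff E 0 ≈ nat q * nat p
  coeff-E-0 = trans (coeff-*ₚ (shift 1# (geom 1# q)) (shift 1# (geom 1# p)) 0)
                    (trans (+-identityˡ _) (*-cong (shift-geom-0 q) (shift-geom-0 p)))

  q≉0 : nat q ≉ 0#
  q≉0 = CharZero⇒nat≉0 charZero q′

  p≉0 : nat p ≉ 0#
  p≉0 = CharZero⇒nat≉0 charZero p′

  K≉0 : K ≉ 0#
  K≉0 = pow-≉0 4 (λ e₀≈0 → *-≉0 q≉0 p≉0 (trans (sym coeff-E-0) e₀≈0))

  degree-G : DegreeBelow n G
  degree-G = degree-shift n (- 1#) (defect E) (degree-defect E n (degree-*ₚ U V (degree q′) (degree p′)))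
    where
    U V : Poly
    U = shift 1# (geom 1# q)
    V = shift 1# (geom 1# p)
    degree : ∀ m → DegreeBelow (suc m) (shift 1# (geom 1# (suc m)))
    degree m = degree-shift (suc m) 1# (geom 1# (suc m)) (proj₁ (monic-geom 1# m))

  G-at-root : ∀ y → eval (geom 1# q) y * eval (geom 1# p) y ≈ 0# → pow (y - 1#) 4 * eval G y ≈ K
  G-at-root y UV≈0 = begin
    pow (y - 1#) 4 * eval G y
      ≈⟨ *-cong (pow-congˡ 4 (+-comm y (- 1#))) (eval-shift (- 1#) (defect E) y) ⟩
    pow w 4 * eval (defect E) w
      ≈⟨ eval-defect E w ⟩
    K - eval (approxInverse E) w * eval E w
      ≈⟨ +-congˡ (-‿cong (*-congˡ E[w]≈0)) ⟩
    K - eval (approxInverse E) w * 0#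
      ≈⟨ trans (+-congˡ (trans (-‿cong (zeroʳ _)) -0#≈0#)) (+-identityʳ K) ⟩
    K ∎
    where
    w : Carrier
    w = - 1# + y
    1+w≈y : 1# + w ≈ y
    1+w≈y = trans (sym (+-assoc _ _ _)) (trans (+-congʳ (-‿inverseʳ 1#)) (+-identityˡ y))
    E[w]≈0 : eval E w ≈ 0#
    E[w]≈0 = begin
      eval E w
        ≈⟨ eval-*ₚ (shift 1# (geom 1# q)) (shift 1# (geom 1# p)) w ⟩
      eval (shift 1# (geom 1# q)) w * eval (shift 1# (geom 1# p)) w
        ≈⟨ *-cong (eval-shift 1# (geom 1# q) w) (eval-shift 1# (geom 1# p) w) ⟩
      eval (geom 1# q) (1# + w) * eval (geom 1# p) (1# + w)
        ≈⟨ *-cong (eval-cong (geom 1# q) 1+w≈y) (eval-cong (geom 1# p) 1+w≈y) ⟩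
      eval (geom 1# q) y * eval (geom 1# p) y
        ≈⟨ UV≈0 ⟩
      0# ∎

  G-at-1# : eval G 1# ≈ - ψ (coeff E)
  G-at-1# = trans (eval-shift (- 1#) (defect E) 1#) (trans (eval-cong (defect E) (-‿inverseˡ 1#)) (eval-defect-0# E))

  ξ-root : ∀ i → pow (pow ξ i) q ≈ 1#
  ξ-root i = pow-root q i (PrimitiveRoot.root ξ-primitive)

  ω-root : ∀ k → pow (pow ω k) p ≈ 1#
  ω-root k = pow-root p k (PrimitiveRoot.root ω-primitive)

  ξ≉1 : ∀ {i} → 1 ℕ.≤ i → i < q → pow ξ i ≉ 1#
  ξ≉1 {i} = PrimitiveRoot.minimal ξ-primitive i

  ω≉1 : ∀ {k} → k < p′ → pow ω (suc k) ≉ 1#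
  ω≉1 {k} k<p′ = PrimitiveRoot.minimal ω-primitive (suc k) (s≤s z≤n) (s≤s k<p′)

  ξ-not-p-root : ∀ {i} → 1 ℕ.≤ i → i < q → pow (pow ξ i) p ≉ 1#
  ξ-not-p-root {i} 1≤i i<q ξⁱᵖ≈1 = ξ≉1 1≤i i<q (coprime-roots {p} {q} coprime ξⁱᵖ≈1 (ξ-root i))

  ω-not-q-root : ∀ {k} → k < p′ → pow (pow ω (suc k)) q ≉ 1#
  ω-not-q-root {k} k<p′ ωᵏᵠ≈1 = ω≉1 k<p′ (coprime-roots {p} {q} coprime (ω-root (suc k)) ωᵏᵠ≈1)

  ξ≉ω : ∀ i {k} → k < p′ → pow ξ i ≉ pow ω (suc k)
  ξ≉ω i k<p′ ξⁱ≈ωᵏ = ω-not-q-root k<p′ (trans (pow-congˡ q (sym ξⁱ≈ωᵏ)) (ξ-root i))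

  -- The roots of N(z) = (z^q - 1)(z^p - 1) / (z - 1): the q-th roots of unity ξⁱ, then the
  -- p-th roots of unity ωᵏ⁺¹ ≠ 1; nodePoly i = N(z) / (z - node i).
  node : ℕ → Carrier
  node = concat q (pow ξ) (λ k → pow ω (suc k))

  nodePoly : ℕ → Poly
  nodePoly = concat q (λ i → geom (pow ξ i) q *ₚ geom 1# p) (λ k → geom 1# q *ₚ geom (pow ω (suc k)) p)

  node-ξ : ∀ {i} → i < q → node i ≡ pow ξ i
  node-ξ = concat-< (pow ξ) (λ k → pow ω (suc k))

  node-ω : ∀ k → node (q ℕ.+ k) ≡ pow ω (suc k)
  node-ω = concat-+ {m = q} (pow ξ) (λ k → pow ω (suc k))

  nodePoly-ξ : ∀ {i} → i < q → nodePoly i ≡ geom (pow ξ i) q *ₚ geom 1# p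
  nodePoly-ξ = concat-< (λ i → geom (pow ξ i) q *ₚ geom 1# p) (λ k → geom 1# q *ₚ geom (pow ω (suc k)) p)

  nodePoly-ω : ∀ k → nodePoly (q ℕ.+ k) ≡ geom 1# q *ₚ geom (pow ω (suc k)) p
  nodePoly-ω = concat-+ {m = q} (λ i → geom (pow ξ i) q *ₚ geom 1# p) (λ k → geom 1# q *ₚ geom (pow ω (suc k)) p)

  distinct : Distinct (suc n) node
  distinct i j i<1+n j<1+n i≢j with split q p′ i<1+n | split q p′ j<1+n
  ... | first i<q | first j<q rewrite node-ξ i<q | node-ξ j<q =
    pow-injective ξ-primitive i<q j<q i≢j
  ... | first {i} i<q | second {k} k<p′ rewrite node-ξ i<q | node-ω k = ξ≉ω i k<p′
  ... | second {k} k<p′ | first {j} j<q rewrite node-ω k | node-ξ j<q = λ ωᵏ≈ξʲ → ξ≉ω j k<p′ (sym ωᵏ≈ξʲ)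
  ... | second {k} k<p′ | second {l} l<p′ rewrite node-ω k | node-ω l =
    pow-injective ω-primitive (s≤s k<p′) (s≤s l<p′) (λ k≡l → i≢j (≡.cong (q ℕ.+_) (ℕₚ.suc-injective k≡l)))

  ω-nodePoly-at-ξ : ∀ {k j} → k < p′ → j < q → eval (geom 1# q *ₚ geom (pow ω (suc k)) p) (pow ξ j) ≈ 0#
  ω-nodePoly-at-ξ {k} {zero}  k<p′ _   = eval-*ₚ-rootʳ (geom 1# q) (geom (pow ω (suc k)) p)
    (geom-root p (trans (pow-1# p) (sym (ω-root (suc k)))) (λ 1≈ωᵏ → ω≉1 k<p′ (sym 1≈ωᵏ)))
  ω-nodePoly-at-ξ {k} {suc j} _   j<q = eval-*ₚ-rootˡ (geom 1# q) (geom (pow ω (suc k)) p)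
    (geom-root q (trans (ξ-root (suc j)) (sym (pow-1# q))) (ξ≉1 (s≤s z≤n) j<q))

  nodePoly-roots : ∀ i j → i < suc n → j < suc n → i ≢ j → eval (nodePoly i) (node j) ≈ 0#
  nodePoly-roots i j i<1+n j<1+n i≢j with split q p′ i<1+n | split q p′ j<1+n
  ... | first {i} i<q | first {j} j<q rewrite nodePoly-ξ i<q | node-ξ j<q =
    eval-*ₚ-rootˡ (geom (pow ξ i) q) (geom 1# p)
      (geom-root q (trans (ξ-root j) (sym (ξ-root i))) (pow-injective ξ-primitive j<q i<q (≢-sym i≢j)))
  ... | first {i} i<q | second {k} k<p′ rewrite nodePoly-ξ i<q | node-ω k =
    eval-*ₚ-rootʳ (geom (pow ξ i) q) (geom 1# p) (geom-root p (trans (ω-root (suc k)) (sym (pow-1# p))) (ω≉1 k<p′))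
  ... | second {k} k<p′ | first j<q rewrite nodePoly-ω k | node-ξ j<q = ω-nodePoly-at-ξ k<p′ j<q
  ... | second {k} k<p′ | second {l} l<p′ rewrite nodePoly-ω k | node-ω l =
    eval-*ₚ-rootʳ (geom 1# q) (geom (pow ω (suc k)) p)
      (geom-root p (trans (ω-root (suc l)) (sym (ω-root (suc k))))
                   (pow-injective ω-primitive (s≤s l<p′) (s≤s k<p′) (λ l≡k → i≢j (≡.cong (q ℕ.+_) (≡.sym (ℕₚ.suc-injective l≡k))))))

  nodePoly-monic : ∀ i → i < suc n → Monic n (nodePoly i)
  nodePoly-monic i i<1+n with split q p′ i<1+n
  ... | first {i} i<q rewrite nodePoly-ξ i<q = monic-*ₚ (geom (pow ξ i) q) (geom 1# p) (monic-geom _ q′) (monic-geom 1# p′)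
  ... | second {k} _  rewrite nodePoly-ω k   = monic-*ₚ (geom 1# q) (geom (pow ω (suc k)) p) (monic-geom 1# q′) (monic-geom _ p′)

  nodePoly≉0 : ∀ i → i < suc n → eval (nodePoly i) (node i) ≉ 0#
  nodePoly≉0 i i<1+n with split q p′ i<1+n
  ... | first {i} i<q rewrite nodePoly-ξ i<q | node-ξ i<q = λ P≈0 →
    *-≉0 (geom-self≉0 q (ξ-root i) q≉0) (p-factor i i<q) (trans (sym (eval-*ₚ (geom (pow ξ i) q) (geom 1# p) (pow ξ i))) P≈0)
    where
    p-factor : ∀ i → i < q → eval (geom 1# p) (pow ξ i) ≉ 0#
    p-factor zero    _   = geom-self≉0 p (pow-1# p) p≉0
    p-factor (suc i) i<q = geom-1#≉0 p (ξ-not-p-root (s≤s z≤n) i<q)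
  ... | second {k} k<p′ rewrite nodePoly-ω k | node-ω k = λ P≈0 →
    *-≉0 (geom-1#≉0 q (ω-not-q-root k<p′)) (geom-self≉0 p (ω-root (suc k)) p≉0)
         (trans (sym (eval-*ₚ (geom 1# q) (geom (pow ω (suc k)) p) (pow ω (suc k)))) P≈0)

  weight : ℕ → Carrier
  weight i = eval G (node i) / eval (nodePoly i) (node i)

  weights-sum≈0 : sumBelow (suc n) weight ≈ 0#
  weights-sum≈0 = interpolation-sum≈0 n node nodePoly G distinct nodePoly-roots nodePoly-monic nodePoly≉0 degree-G

  weight-1# : nat q * nat p * weight 0 ≈ eval G 1#
  weight-1# rewrite node-ξ {0} (s≤s z≤n) | nodePoly-ξ {0} (s≤s z≤n) = begin
    nat q * nat p * (eval G 1# / D)    ≈⟨ *-comm _ _ ⟩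
    (eval G 1# / D) * (nat q * nat p)  ≈⟨ *-congˡ D≈qp ⟨
    (eval G 1# / D) * D                ≈⟨ /-*-cancel (λ D≈0 → *-≉0 q≉0 p≉0 (trans (sym D≈qp) D≈0)) ⟩
    eval G 1#                          ∎
    where
    D = eval (geom 1# q *ₚ geom 1# p) 1#
    D≈qp : D ≈ nat q * nat p
    D≈qp = trans (eval-*ₚ (geom 1# q) (geom 1# p) 1#) (*-cong (eval-geom-1#-1# q) (eval-geom-1#-1# p))

  summand : ℕ → Carrier → Carrier
  summand m r = r / (pow (r - 1#) 3 * (pow r m - 1#))

  ξ-summand : ∀ {i} → i < q′ → K * summand p (pow ξ (suc i)) ≈ nat q * weight (suc i)
  ξ-summand {i} i<q′ rewrite node-ξ (s≤s i<q′) | nodePoly-ξ (s≤s i<q′) =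
    summand-rescale r≉1 rᵖ≉1 (λ D≈0 → *-≉0 a≉0 b≉0 (trans (sym D≈ab) D≈0)) D≈ab
      (G-at-root r (trans (*-congʳ (geom-root q (trans (ξ-root (suc i)) (sym (pow-1# q))) r≉1)) (zeroˡ _)))
      (trans (geom-self r q) (trans (*-congˡ (ξ-root (suc i))) (*-identityʳ _)))
      (trans (geom-eval 1# p r) (+-congˡ (-‿cong (pow-1# p))))
    where
    r : Carrier
    r = pow ξ (suc i)
    r≉1 : r ≉ 1#
    r≉1 = ξ≉1 (s≤s z≤n) (s≤s i<q′)
    rᵖ≉1 : pow r p ≉ 1#
    rᵖ≉1 = ξ-not-p-root (s≤s z≤n) (s≤s i<q′)
    a≉0 : eval (geom r q) r ≉ 0#
    a≉0 = geom-self≉0 q (ξ-root (suc i)) q≉0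
    b≉0 : eval (geom 1# p) r ≉ 0#
    b≉0 = geom-1#≉0 p rᵖ≉1
    D≈ab : eval (geom r q *ₚ geom 1# p) r ≈ eval (geom r q) r * eval (geom 1# p) r
    D≈ab = eval-*ₚ (geom r q) (geom 1# p) r

  ω-summand : ∀ {k} → k < p′ → K * summand q (pow ω (suc k)) ≈ nat p * weight (q ℕ.+ k)
  ω-summand {k} k<p′ rewrite node-ω k | nodePoly-ω k =
    summand-rescale r≉1 rᵠ≉1 (λ D≈0 → *-≉0 a≉0 b≉0 (trans (sym D≈ab) D≈0)) D≈ab
      (G-at-root r (trans (*-congˡ (geom-root p (trans (ω-root (suc k)) (sym (pow-1# p))) r≉1)) (zeroʳ _)))
      (trans (geom-self r p) (trans (*-congˡ (ω-root (suc k))) (*-identityʳ _)))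
      (trans (geom-eval 1# q r) (+-congˡ (-‿cong (pow-1# q))))
    where
    r : Carrier
    r = pow ω (suc k)
    r≉1 : r ≉ 1#
    r≉1 = ω≉1 k<p′
    rᵠ≉1 : pow r q ≉ 1#
    rᵠ≉1 = ω-not-q-root k<p′
    a≉0 : eval (geom r p) r ≉ 0#
    a≉0 = geom-self≉0 p (ω-root (suc k)) p≉0
    b≉0 : eval (geom 1# q) r ≉ 0#
    b≉0 = geom-1#≉0 q rᵠ≉1
    D≈ab : eval (geom 1# q *ₚ geom r p) r ≈ eval (geom r p) r * eval (geom 1# q) r
    D≈ab = trans (eval-*ₚ (geom 1# q) (geom r p) r) (*-comm _ _)

  ξ-sum : K * sum₁ q (summand p ∘ pow ξ) ≈ nat q * sumBelow q′ (λ i → weight (suc i))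
  ξ-sum = begin
    K * sumBelow q′ (λ i → summand p (pow ξ (suc i)))     ≈⟨ *-distribˡ-sumBelow q′ K _ ⟩
    sumBelow q′ (λ i → K * summand p (pow ξ (suc i)))     ≈⟨ sumBelow-cong q′ (λ _ → ξ-summand) ⟩
    sumBelow q′ (λ i → nat q * weight (suc i))            ≈⟨ *-distribˡ-sumBelow q′ (nat q) _ ⟨
    nat q * sumBelow q′ (λ i → weight (suc i))            ∎

  ω-sum : K * sum₁ p (summand q ∘ pow ω) ≈ nat p * sumBelow p′ (λ k → weight (q ℕ.+ k))
  ω-sum = begin
    K * sumBelow p′ (λ k → summand q (pow ω (suc k)))     ≈⟨ *-distribˡ-sumBelow p′ K _ ⟩
    sumBelow p′ (λ k → K * summand q (pow ω (suc k)))     ≈⟨ sumBelow-cong p′ (λ _ → ω-summand) ⟩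
    sumBelow p′ (λ k → nat p * weight (q ℕ.+ k))          ≈⟨ *-distribˡ-sumBelow p′ (nat p) _ ⟨
    nat p * sumBelow p′ (λ k → weight (q ℕ.+ k))          ∎

  other-weights : sumBelow q′ (λ i → weight (suc i)) + sumBelow p′ (λ k → weight (q ℕ.+ k)) ≈ - weight 0
  other-weights = begin
    Wξ + Wω                                ≈⟨ solve 3 (λ w₀ a b → a :+ b := :- w₀ :+ (w₀ :+ a :+ b)) refl (weight 0) Wξ Wω ⟩
    - weight 0 + (weight 0 + Wξ + Wω)      ≈⟨ +-congˡ (+-congʳ (sumBelow-sucˡ q′ weight)) ⟨
    - weight 0 + (sumBelow q weight + Wω)  ≈⟨ +-congˡ (sumBelow-+ q p′ weight) ⟨
    - weight 0 + sumBelow (suc n) weight   ≈⟨ +-congˡ weights-sum≈0 ⟩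
    - weight 0 + 0#                        ≈⟨ +-identityʳ _ ⟩
    - weight 0                             ∎
    where
    Wξ Wω : Carrier
    Wξ = sumBelow q′ (λ i → weight (suc i))
    Wω = sumBelow p′ (λ k → weight (q ℕ.+ k))

  total : Carrier
  total = nat p * sum₁ q (summand p ∘ pow ξ) + nat q * sum₁ p (summand q ∘ pow ω)

  K*total : K * total ≈ ψ (coeff E)
  K*total = begin
    K * (nat p * Sξ + nat q * Sω)
      ≈⟨ solve 5 (λ K P Q Sξ Sω → K :* (P :* Sξ :+ Q :* Sω) := P :* (K :* Sξ) :+ Q :* (K :* Sω))
              refl K (nat p) (nat q) Sξ Sω ⟩
    nat p * (K * Sξ) + nat q * (K * Sω)
      ≈⟨ +-cong (*-congˡ ξ-sum) (*-congˡ ω-sum) ⟩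
    nat p * (nat q * Wξ) + nat q * (nat p * Wω)
      ≈⟨ solve 4 (λ P Q a b → P :* (Q :* a) :+ Q :* (P :* b) := Q :* P :* (a :+ b))
              refl (nat p) (nat q) Wξ Wω ⟩
    nat q * nat p * (Wξ + Wω)
      ≈⟨ *-congˡ other-weights ⟩
    nat q * nat p * - weight 0
      ≈⟨ -‿distribʳ-* _ _ ⟨
    - (nat q * nat p * weight 0)
      ≈⟨ -‿cong (trans weight-1# G-at-1#) ⟩
    - - ψ (coeff E)
      ≈⟨ -‿involutive _ ⟩
    ψ (coeff E) ∎
    where
    Sξ Sω Wξ Wω : Carrier
    Sξ = sum₁ q (summand p ∘ pow ξ)
    Sω = sum₁ p (summand q ∘ pow ω)
    Wξ = sumBelow q′ (λ i → weight (suc i))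
    Wω = sumBelow p′ (λ k → weight (q ℕ.+ k))

  total*720 : total * nat 720 ≈ rhsValue (nat p) (nat q)
  total*720 = *-cancelˡ K≉0 (begin
    K * (total * nat 720)
      ≈⟨ solve 3 (λ K T N → K :* (T :* N) := N :* (K :* T)) refl K total (nat 720) ⟩
    nat 720 * (K * total)
      ≈⟨ *-congˡ K*total ⟩
    nat 720 * ψ (coeff E)
      ≈⟨ ψ-taylor p q ⟩
    pow (nat q * nat p) 4 * rhsValue (nat p) (nat q)
      ≈⟨ *-congʳ (pow-congˡ 4 coeff-E-0) ⟨
    K * rhsValue (nat p) (nat q) ∎)

  sum-identity : fromℕ p * sum₁ q (summand p ∘ pow ξ) + fromℕ q * sum₁ p (summand q ∘ pow ω) ≈ fromℤ (rhsPoly p q) / fromℕ 720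
  sum-identity = x*y≈z⇒x≈z/y (charZero 719) (begin
    (fromℕ p * sum₁ q (summand p ∘ pow ξ) + fromℕ q * sum₁ p (summand q ∘ pow ω)) * fromℕ 720
      ≈⟨ *-cong (+-cong (*-congʳ (sym (nat≈fromℕ p))) (*-congʳ (sym (nat≈fromℕ q)))) (sym (nat≈fromℕ 720)) ⟩
    total * nat 720           ≈⟨ total*720 ⟩
    rhsValue (nat p) (nat q)  ≈⟨ int-rhsPoly p q ⟨
    int (rhsPoly p q)         ≈⟨ int≈fromℤ (rhsPoly p q) ⟩
    fromℤ (rhsPoly p q)       ∎)


lemma4p4 : ∀ {c ℓ : Level} (F : Field c ℓ) → FieldOps.CharZero F →
           (p q : ℕ) → 2 ≤ p → 2 ≤ q → gcd p q ≡ 1 →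
           (ω ξ : Field.Carrier F) →
           FieldOps.PrimitiveRoot F p ω → FieldOps.PrimitiveRoot F q ξ →
           let open Field F
               open FieldOps F
               ξj = λ j → pow ξ j
               ωj = λ j → pow ω j
           in (fromℕ p * sum₁ q (λ j → ξj j / (pow (ξj j - 1#) 3 * (pow (ξj j) p - 1#))))
              + (fromℕ q * sum₁ p (λ j → ωj j / (pow (ωj j - 1#) 3 * (pow (ωj j) q - 1#))))
              ≈ fromℤ (rhsPoly p q) / fromℕ 720
lemma4p4 F charZero (suc p′) (suc q′) (s≤s _) (s≤s _) coprime ω ξ ω-primitive ξ-primitive =
  CoprimeRootSums.sum-identity F charZero p′ q′ coprime ω ξ ω-primitive ξ-primitive
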